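{- Let $n\ge 5$, $T\in\mathcal{T}^{(2)}_n$, and $(P,Q)=\widetilde\Psi(T)\in\mathcal{D}^{(2)}_{n-4}$. For $4\le j\le n$ let $h_j$ be the number of nontrivial diagonals of $T$ of the form $(a,j)$ with $a<j$, and for $1\le j\le n-4$ let $p_j=p_j(P,Q)$, $q_j=q_j(P,Q)$. Then $$(h_4,h_5,\dots,h_{n-1},h_n)=(q_{n-4},\,p_{n-4}+q_{n-5},\,\dots,\,p_2+q_1,\,p_1).$$
   Context: 2-triangulations: vertices of a convex $n$-gon labeled $1,\dots,n$ clockwise, $(a,b)$ with $a<b$ the diagonal joining $a,b$ (labels modulo $n$ when needed); a 2-triangulation is a maximal set of diagonals no three pairwise crossing (crossing = intersecting in interiors); $\mathcal{T}^{(2)}_n$ is their set. Diagonals joining vertices at cyclic distance $2$ are trivial and lie in every 2-triangulation; a 2-triangulation is identified with its set of nontrivial diagonals; $\deg(v)$ is the number of nontrivial diagonals incident to $v$. For $n\ge 6$, $T\in\mathcal{T}^{(2)}_n$, let $r=\max\{a:1\le a\le n-3,(a,a+3)\in T\}$. $p(T)\in\mathcal{T}^{(2)}_{n-1}$ is obtained by: deleting $(r,r+3)$; then if $\deg(r+1)=0$ deleting $(r-1,r+2)$, if $\deg(r+2)=0$ deleting $(1,r+1)$, and if both degrees are positive deleting $(j,r+2)$ with $j=\max\{a:1\le a<r,(a,r+2)\in T\}$; then contracting the side $(r+1,r+2)$ (diagonals ending at $r+2$ are moved to end at $r+1$, vertex $r+2$ removed, labels $b>r+2$ decrease by one). The label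 of $T$ is $(h_{r+1},\dots,h_{n-1})$ for $n\ge 6$ (with $h_j$ as in the claim), and $(0,0)$ for the unique 2-triangulation of the pentagon. Dyck paths: a Dyck path of size $m$ is an $N=(0,1)$, $E=(1,0)$ path from $(0,0)$ to $(m,m)$ never below $y=x$; $\mathcal{D}^{(2)}_m$ is the set of pairs $(P,Q)$ of them with $P$ never below $Q$. Write $P=NE^{p_m}\cdots NE^{p_1}E$, $Q=NE^{q_m}\cdots NE^{q_1}E$, set $p_{m+1}=p_{m+2}=q_{m+1}=0$, and $s=\min\{j\ge 2:p_jq_j=0\}$. For $m\ge 2$ the parent $\pi(P,Q)\in\mathcal{D}^{(2)}_{m-1}$ has $p'_i=p_i$ ($i\le s-2$), $p'_{s-1}=p_{s-1}-1$, $p'_s=p_s+p_{s+1}$, $p'_i=p_{i+1}$ ($s+1\le i\le m-1$), $q'_i=q_i$ ($i\le s-2$), $q'_{s-1}=q_{s-1}+q_s-1$, $q'_i=q_{i+1}$ ($s\le i\le m-1$). The label of $(P,Q)$ is $(p_{s+1}+q_s,\,p_s+q_{s-1},\dots,p_2+q_1)$. The map $\widetilde\Psi$: it sends the 2-triangulation of the pentagon to $(NE,NE)\in\mathcal{D}^{(2)}_1$, and for $n\ge 6$, $\widetilde\Psi(T)$ is the unique pair $(P,Q)\in\mathcal{D}^{(2)}_{n-4}$ with $\pi(P,Q)=\widetilde\Psi(p(T))$ whose label equals the label of $T$ (such a pair exists and is unique, so $\widetilde\Psi$ is a well-defined bijection $\mathcal{T}^{(2)}_n\to\mathcal{D}^{(2)}_{n-4}$).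 -}

module Defs where

open import Data.Bool using (Bool; true; false; _∧_; _∨_; not; if_then_else_)
open import Data.Nat using (ℕ; zero; suc; _+_; _*_; _∸_; _≤_; _≤ᵇ_; _≡ᵇ_)
open import Data.List using (List; []; _∷_; _++_; map; replicate; take; upTo; reverse)
open import Data.Nat.ListAction using (sum)
open import Data.Bool.ListAction using (any)
open import Data.Product using (_×_; _,_; proj₁; proj₂)
open import Relation.Binary.PropositionalEquality using (_≡_)
open import Data.Empty using (⊥)

range : ℕ → ℕ → List ℕ
range a b = map (a +_) (upTo (suc b ∸ a))

countB : (ℕ → Bool) → List ℕ → ℕ
countB f xs = sum (map (λ x → if f x then 1 else 0) xs)

-- largest a with 1 ≤ a ≤ k and f a = true (0 if there is none)
findMax : (ℕ → Bool) → ℕ → ℕ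
findMax f zero    = 0
findMax f (suc k) = if f (suc k) then suc k else findMax f k

-- smallest j ≥ j₀ with f j = true, searching j₀, …, j₀+fuel-1
-- (returns j₀+fuel if none is found)
findMinFrom : (ℕ → Bool) → ℕ → ℕ → ℕ
findMinFrom f j zero       = j
findMinFrom f j (suc fuel) = if f j then j else findMinFrom f (suc j) fuel

-- Diagonals of a convex n-gon with vertices 1..n.
-- A set of diagonals is a boolean membership function on pairs (a , b),
-- used only for a < b.

DiagSet : Set
DiagSet = ℕ → ℕ → Bool

isDiag : ℕ → ℕ → ℕ → Bool
isDiag n a b = (1 ≤ᵇ a) ∧ (a + 2 ≤ᵇ b) ∧ (b ≤ᵇ n) ∧ (b + 2 ≤ᵇ a + n)

isTrivial : ℕ → ℕ → ℕ → Bool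
isTrivial n a b = (1 ≤ᵇ a) ∧ (b ≤ᵇ n) ∧ ((a + 2 ≡ᵇ b) ∨ (b + 2 ≡ᵇ a + n))

isNontrivial : ℕ → ℕ → ℕ → Bool
isNontrivial n a b = (1 ≤ᵇ a) ∧ (a + 3 ≤ᵇ b) ∧ (b ≤ᵇ n) ∧ (b + 3 ≤ᵇ a + n)

Cross : ℕ → ℕ → ℕ → ℕ → Set
Cross a b c d = ((suc a ≤ c) × (suc c ≤ b) × (suc b ≤ d))
              ⊎' ((suc c ≤ a) × (suc a ≤ d) × (suc d ≤ b))
  where
  open import Data.Sum renaming (_⊎_ to _⊎'_)

NoThreeCrossing : DiagSet → Set
NoThreeCrossing S =
  ∀ a b c d e f → S a b ≡ true → S c d ≡ true → S e f ≡ true →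
  Cross a b c d → Cross a b e f → Cross c d e f → ⊥

addDiag : DiagSet → ℕ → ℕ → DiagSet
addDiag S a b x y = S x y ∨ ((x ≡ᵇ a) ∧ (y ≡ᵇ b))

Is2Triangulation : ℕ → DiagSet → Set
Is2Triangulation n S =
  (∀ a b → S a b ≡ true → isDiag n a b ≡ true) ×
  NoThreeCrossing S ×
  (∀ a b → isDiag n a b ≡ true → S a b ≡ false →
     NoThreeCrossing (addDiag S a b) → ⊥)

-- T (a set of nontrivial diagonals) is (the nontrivial part of) a
-- 2-triangulation: T together with all trivial diagonals is a 2-triangulation.
IsTwoTri : ℕ → DiagSet → Set
IsTwoTri n T =
  (∀ a b → T a b ≡ true → isNontrivial n a b ≡ true) ×
  Is2Triangulation n (λ a b → T a b ∨ isTrivial n a b)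

hStat : DiagSet → ℕ → ℕ
hStat T j = countB (λ a → T a j) (range 1 (j ∸ 1))

deg : ℕ → DiagSet → ℕ → ℕ
deg n T v = countB (λ u → T v u ∨ T u v) (range 1 n)

rIdx : ℕ → DiagSet → ℕ
rIdx n T = findMax (λ a → T a (a + 3)) (n ∸ 3)

labelT : ℕ → DiagSet → List ℕ
labelT n T = map (hStat T) (range (suc (rIdx n T)) (n ∸ 1))

ordPair : ℕ → ℕ → ℕ × ℕ
ordPair x y = if x ≤ᵇ y then (x , y) else (y , x)

parentT : ℕ → DiagSet → DiagSet
parentT n T = T'
  where
  r : ℕ
  r = rIdx n T
  j : ℕ
  j = findMax (λ a → T a (r + 2)) (r ∸ 1)
  -- vertex r-1, read modulo n (vertex 0 is vertex n)
  rm1 : ℕ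
  rm1 = if r ≡ᵇ 1 then n else r ∸ 1
  d1pos : Bool
  d1pos = not (deg n T (r + 1) ≡ᵇ 0)
  d2pos : Bool
  d2pos = not (deg n T (r + 2) ≡ᵇ 0)
  dels : List (ℕ × ℕ)
  dels = (r , r + 3)
       ∷ ((if d1pos then [] else ordPair rm1 (r + 2) ∷ [])
       ++ (if d2pos then [] else (1 , r + 1) ∷ [])
       ++ (if d1pos ∧ d2pos then (j , r + 2) ∷ [] else []))
  isDel : ℕ → ℕ → Bool
  isDel a b = any (λ pr → (proj₁ pr ≡ᵇ a) ∧ (proj₂ pr ≡ᵇ b)) dels
  D : DiagSet
  D a b = T a b ∧ not (isDel a b)
  -- old labels mapped to a new label by contracting the side (r+1, r+2)
  pre : ℕ → List ℕ
  pre x = if x ≤ᵇ r then x ∷ []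
          else (if x ≡ᵇ suc r then suc r ∷ r + 2 ∷ [] else suc x ∷ [])
  T' : DiagSet
  T' a b = isNontrivial (n ∸ 1) a b ∧
           any (λ a' → any (λ b' → D a' b' ∨ D b' a') (pre b)) (pre a)

data Step : Set where
  N E : Step

Path : Set
Path = List Step

countN : Path → ℕ
countN []      = 0
countN (N ∷ w) = suc (countN w)
countN (E ∷ w) = countN w

countE : Path → ℕ
countE []      = 0
countE (N ∷ w) = countE w
countE (E ∷ w) = suc (countE w)

IsDyck : ℕ → Path → Set
IsDyck m P = (countN P ≡ m) × (countE P ≡ m) ×
             (∀ k → countE (take k P) ≤ countN (take k P))

IsDyckPair : ℕ → Path → Path → Set
IsDyckPair m P Q = IsDyck m P × IsDyck m Q ×
                   (∀ k → countN (take k Q) ≤ countN (take k P))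

-- exponents: for P = N E^{p_m} ⋯ N E^{p_1} E, expList P = [p_1, …, p_m]
private
  runs : List ℕ → Path → List ℕ
  runs acc []            = acc
  runs acc (N ∷ w)       = runs (0 ∷ acc) w
  runs []  (E ∷ w)       = runs [] w
  runs (k ∷ acc) (E ∷ w) = runs (suc k ∷ acc) w

  decHead : List ℕ → List ℕ
  decHead []       = []
  decHead (k ∷ ks) = (k ∸ 1) ∷ ks

expList : Path → List ℕ
expList P = decHead (runs [] P)

-- 1-indexed access with default 0 (so x_0 = 0 and x_j = 0 for j > m)
getIdx : List ℕ → ℕ → ℕ
getIdx xs       zero          = 0
getIdx []       (suc j)       = 0
getIdx (x ∷ xs) (suc zero)    = x
getIdx (x ∷ xs) (suc (suc j)) = getIdx xs (suc j)

pE : Path → ℕ → ℕ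
pE P = getIdx (expList P)

private
  mkSegs : List ℕ → Path
  mkSegs []       = []
  mkSegs (x ∷ xs) = mkSegs xs ++ (N ∷ replicate x E)

fromExps : List ℕ → Path
fromExps xs = mkSegs xs ++ (E ∷ [])

sIdx : ℕ → Path → Path → ℕ
sIdx m P Q = findMinFrom (λ j → pE P j * pE Q j ≡ᵇ 0) 2 m

labelD : ℕ → Path → Path → List ℕ
labelD m P Q = map (λ i → pE P (suc i) + pE Q i) (reverse (range 1 (sIdx m P Q)))

piP : ℕ → Path → Path → Path
piP m P Q = fromExps (map p' (range 1 (m ∸ 1)))
  where
  s = sIdx m P Q
  p = pE P
  p' : ℕ → ℕ
  p' i = if i ≤ᵇ s ∸ 2 then p i
         else (if i ≡ᵇ s ∸ 1 then p (s ∸ 1) ∸ 1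
         else (if i ≡ᵇ s then p s + p (suc s)
         else p (suc i)))

piQ : ℕ → Path → Path → Path
piQ m P Q = fromExps (map q' (range 1 (m ∸ 1)))
  where
  s = sIdx m P Q
  q = pE Q
  q' : ℕ → ℕ
  q' i = if i ≤ᵇ s ∸ 2 then q i
         else (if i ≡ᵇ s ∸ 1 then (q (s ∸ 1) + q s) ∸ 1
         else q (suc i))

-- The bijection Ψ̃ : T^(2)_n → D^(2)_{n-4}, as its graph:
-- PsiGraph n T P Q  means  Ψ̃(T) = (P , Q).

data PsiGraph : ℕ → DiagSet → Path → Path → Set where
  base : ∀ T → IsTwoTri 5 T →
         PsiGraph 5 T (N ∷ E ∷ []) (N ∷ E ∷ [])
  step : ∀ n T P Q → 6 ≤ n → IsTwoTri n T →
         IsDyckPair (n ∸ 4) P Q →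
         PsiGraph (n ∸ 1) (parentT n T) (piP (n ∸ 4) P Q) (piQ (n ∸ 4) P Q) →
         labelD (n ∸ 4) P Q ≡ labelT n T →
         PsiGraph n T P Q

-- Induction along the recursive definition of Ψ̃, proving h_j = p_{i+1} + q_i whenever
-- i + j = n. Let r be the largest a with (a, a+3) ∈ T and s the index used by π. The labels
-- of T and (P, Q) agree, so s = n − 1 − r, and the label itself gives h_j for r < j < n.
-- By maximality every nontrivial diagonal (a, b) of T contains an ear (a′, a′+3) ∈ T with
-- a ≤ a′, so all left endpoints are at most r. Hence p(T) keeps the diagonals ending at
-- j ≤ r, and turns those ending at n into those ending at n − 1, except the ear (r, n) when
-- r = n − 3, i.e. s = 2. Since π only shifts the exponents beyond s, induction gives h_j
-- for j ≤ r, and h_n = p′₁ + [s = 2] = p₁, where p₁ ≥ 1 when s = 2 because a Dyck pair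
-- with p₁ = 0 has p₂q₂ ≠ 0.

module Submission where

open import Defs
open import Data.Nat using (ℕ; _+_; _∸_; _≤_)
open import Data.List using (List; _∷_; []; _++_; map; reverse)
open import Relation.Binary.PropositionalEquality using (_≡_)

open import Data.Bool using (Bool; true; false; _∧_; _∨_; not; if_then_else_)
open import Data.Bool.ListAction using (any)
open import Data.Bool.Properties using (∧-zeroʳ; ∧-identityʳ; ∨-identityʳ)
open import Data.Empty using (⊥; ⊥-elim)
open import Data.List using (_∷ʳ_; applyUpTo; length; replicate; take; upTo)
open import Data.List.Properties
  using (++-assoc; ++-identityʳ; length-++; length-map; length-reverse; length-upTo; map-++; map-applyUpTo; map-cong;
         reverse-++; unfold-reverse; ∷-injective)
open import Data.List.Relation.Unary.All using (All; []; _∷_) renaming (map to All-map)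
open import Data.List.Relation.Unary.All.Properties using (++⁺)
open import Data.Nat using (zero; suc; _<_; _≰_; _*_; _≤ᵇ_; _≡ᵇ_; _≟_; _≤?_; z<s; s≤s; z≤n)
open import Data.Nat.Induction using (<-wellFounded)
open import Data.Nat.ListAction using (sum)
open import Data.Nat.ListAction.Properties using (sum-++)
open import Data.Nat.Properties
open import Algebra.Properties.CommutativeSemigroup +-commutativeSemigroup using (interchange)
open import Data.Product using (Σ; Σ-syntax; _×_; _,_; proj₁; proj₂)
open import Data.Sum using (_⊎_; inj₁; inj₂)
open import Function using (_⇔_; mk⇔; Equivalence; _∘_; _∋_; id)
open import Induction.WellFounded using (Acc; acc)
open import Relation.Binary.PropositionalEquality
  using (_≢_; ≢-sym; refl; sym; trans; cong; cong₂; subst; subst₂; module ≡-Reasoning)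
open import Relation.Nullary using (¬_; contradiction; yes; no)
open import Relation.Nullary.Reflects using (Reflects; ofʸ; ofⁿ; fromEquivalence; _×-reflects_; _⊎-reflects_)

reflects-true : ∀ {A : Set} {b} → Reflects A b → A → b ≡ true
reflects-true (ofʸ _) _ = refl
reflects-true (ofⁿ ¬a) a = contradiction a ¬a

reflects-false : ∀ {A : Set} {b} → Reflects A b → ¬ A → b ≡ false
reflects-false (ofʸ a) ¬a = contradiction a ¬a
reflects-false (ofⁿ _) _ = refl

reflects-sound : ∀ {A : Set} {b} → Reflects A b → b ≡ true → A
reflects-sound (ofʸ a) _ = a

≡ᵇ-reflects-≡ : ∀ m n → Reflects (m ≡ n) (m ≡ᵇ n)
≡ᵇ-reflects-≡ m n = fromEquivalence (≡ᵇ⇒≡ m n) (≡⇒≡ᵇ m n)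

≤ᵇ-true : ∀ {m n} → m ≤ n → (m ≤ᵇ n) ≡ true
≤ᵇ-true = reflects-true (≤ᵇ-reflects-≤ _ _)

≤ᵇ-false : ∀ {m n} → n < m → (m ≤ᵇ n) ≡ false
≤ᵇ-false n<m = reflects-false (≤ᵇ-reflects-≤ _ _) (<⇒≱ n<m)

≡ᵇ-true : ∀ {m n} → m ≡ n → (m ≡ᵇ n) ≡ true
≡ᵇ-true = reflects-true (≡ᵇ-reflects-≡ _ _)

≡ᵇ-false : ∀ {m n} → m ≢ n → (m ≡ᵇ n) ≡ false
≡ᵇ-false = reflects-false (≡ᵇ-reflects-≡ _ _)

≡ᵇ-sound : ∀ {m n} → (m ≡ᵇ n) ≡ true → m ≡ n
≡ᵇ-sound = reflects-sound (≡ᵇ-reflects-≡ _ _)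

≡ᵇ-≡ : ∀ {m n m′ n′} → (m ≡ n → m′ ≡ n′) → (m′ ≡ n′ → m ≡ n) → (m ≡ᵇ n) ≡ (m′ ≡ᵇ n′)
≡ᵇ-≡ {m} {n} {m′} {n′} to from with m ≡ᵇ n | ≡ᵇ-reflects-≡ m n
... | true  | ofʸ m≡n = sym (≡ᵇ-true (to m≡n))
... | false | ofⁿ m≢n = sym (≡ᵇ-false (m≢n ∘ from))

ind : Bool → ℕ
ind b = if b then 1 else 0

∧-redundantˡ : ∀ {c x} → (x ≡ true → c ≡ true) → c ∧ x ≡ x
∧-redundantˡ {x = true} x⇒c rewrite x⇒c refl = refl
∧-redundantˡ {c} {false} _ = ∧-zeroʳ c

∧-not-true : ∀ {x y} → x ∧ not y ≡ true → x ≡ true × y ≡ false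
∧-not-true {true} {false} _ = refl , refl

ind-split : ∀ {x y} → (y ≡ true → x ≡ true) → ind x ≡ ind (x ∧ not y) + ind y
ind-split {true} {true} _ = refl
ind-split {true} {false} _ = refl
ind-split {false} {false} _ = refl
ind-split {false} {true} y⇒x with () ← y⇒x refl

findMax-≤ : ∀ f k → findMax f k ≤ k
findMax-≤ f zero = z≤n
findMax-≤ f (suc k) with f (suc k)
... | true = ≤-refl
... | false = m≤n⇒m≤1+n (findMax-≤ f k)

findMax-maximal : ∀ f k {a} → f a ≡ true → 1 ≤ a → a ≤ k → a ≤ findMax f k
findMax-maximal f zero fa 1≤a a≤0 = contradiction a≤0 (<⇒≱ 1≤a)
findMax-maximal f (suc k) fa 1≤a a≤k with f (suc k) in eq | m≤n⇒m<n∨m≡n a≤k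
... | true | _ = a≤k
... | false | inj₁ a<1+k = findMax-maximal f k fa 1≤a (≤-pred a<1+k)
... | false | inj₂ refl with () ← trans (sym fa) eq

findMax-holds : ∀ f k → 1 ≤ findMax f k → f (findMax f k) ≡ true
findMax-holds f (suc k) pos with f (suc k) in eq
... | true = eq
... | false = findMax-holds f k pos

findMinFrom-≥ : ∀ f j fuel → j ≤ findMinFrom f j fuel
findMinFrom-≥ f j zero = ≤-refl
findMinFrom-≥ f j (suc fuel) with f j
... | true = ≤-refl
... | false = <⇒≤ (findMinFrom-≥ f (suc j) fuel)

findMinFrom-minimal : ∀ f j fuel {k} → f k ≡ true → j ≤ k → k < j + fuel → findMinFrom f j fuel ≤ k
findMinFrom-minimal f j zero {k} fk j≤k k<j+0 = contradiction (subst (k <_) (+-identityʳ j) k<j+0) (≤⇒≯ j≤k)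
findMinFrom-minimal f j (suc fuel) {k} fk j≤k k<j+fuel with f j in eq | m≤n⇒m<n∨m≡n j≤k
... | true | _ = j≤k
... | false | inj₁ j<k = findMinFrom-minimal f (suc j) fuel fk j<k (subst (k <_) (+-suc j fuel) k<j+fuel)
... | false | inj₂ refl with () ← trans (sym fk) eq

findMinFrom-holds : ∀ f j fuel → findMinFrom f j fuel < j + fuel → f (findMinFrom f j fuel) ≡ true
findMinFrom-holds f j zero lt = contradiction (subst (j <_) (+-identityʳ j) lt) (<-irrefl refl)
findMinFrom-holds f j (suc fuel) lt with f j in eq
... | true = eq
... | false = findMinFrom-holds f (suc j) fuel (subst (findMinFrom f (suc j) fuel <_) (+-suc j fuel) lt)

upFrom : ℕ → ℕ → List ℕ
upFrom c zero    = []
upFrom c (suc k) = c ∷ upFrom (suc c) k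

applyUpTo-upFrom : ∀ {f : ℕ → ℕ} c k → (∀ i → f i ≡ c + i) → applyUpTo f k ≡ upFrom c k
applyUpTo-upFrom c zero    f≗ = refl
applyUpTo-upFrom c (suc k) f≗ =
  cong₂ _∷_ (trans (f≗ 0) (+-identityʳ c)) (applyUpTo-upFrom (suc c) k (λ i → trans (f≗ (suc i)) (+-suc c i)))

range-upFrom : ∀ a b → range a b ≡ upFrom a (suc b ∸ a)
range-upFrom a b = trans (map-applyUpTo id (a +_) (suc b ∸ a)) (applyUpTo-upFrom a _ (λ _ → refl))

length-range : ∀ a b → length (range a b) ≡ suc b ∸ a
length-range a b = trans (length-map (a +_) (upTo (suc b ∸ a))) (length-upTo (suc b ∸ a))

range-∷ : ∀ {a b} → a ≤ b → range a b ≡ a ∷ range (suc a) b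
range-∷ {a} {b} a≤b rewrite range-upFrom a b | range-upFrom (suc a) b | +-∸-assoc 1 a≤b = refl

upFrom-∷ʳ : ∀ c k → upFrom c (suc k) ≡ upFrom c k ∷ʳ (c + k)
upFrom-∷ʳ c zero    = cong (_∷ []) (sym (+-identityʳ c))
upFrom-∷ʳ c (suc k) =
  cong (c ∷_) (trans (upFrom-∷ʳ (suc c) k) (cong (λ x → upFrom (suc c) k ∷ʳ x) (sym (+-suc c k))))

range-∷ʳ : ∀ {a b} → a ≤ suc b → range a (suc b) ≡ range a b ∷ʳ suc b
range-∷ʳ {a} {b} a≤1+b rewrite range-upFrom a (suc b) | range-upFrom a b | +-∸-assoc 1 a≤1+b
  = trans (upFrom-∷ʳ a (suc b ∸ a)) (cong (λ x → upFrom a (suc b ∸ a) ∷ʳ x) (m+[n∸m]≡n a≤1+b))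

map-cong-upFrom : ∀ {h g : ℕ → ℕ} c k → (∀ x → c ≤ x → x < c + k → h x ≡ g x) →
                  map h (upFrom c k) ≡ map g (upFrom c k)
map-cong-upFrom c zero    h≗g = refl
map-cong-upFrom c (suc k) h≗g = cong₂ _∷_ (h≗g c ≤-refl (m<m+n c z<s))
  (map-cong-upFrom (suc c) k (λ x c<x x<c+k → h≗g x (<⇒≤ c<x) (subst (x <_) (sym (+-suc c k)) x<c+k)))

upFrom-range-bound : ∀ {a b x} → a ≤ x → x < a + (suc b ∸ a) → x ≤ b
upFrom-range-bound {a} {b} {x} a≤x x<a+k with a ≤? suc b
... | yes a≤1+b = ≤-pred (subst (x <_) (m+[n∸m]≡n a≤1+b) x<a+k)
... | no a≰1+b = contradiction (subst (x <_) a+0≡a x<a+k) (≤⇒≯ a≤x)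
  where
  a+0≡a : a + (suc b ∸ a) ≡ a
  a+0≡a = trans (cong (a +_) (m≤n⇒m∸n≡0 (<⇒≤ (≰⇒> a≰1+b)))) (+-identityʳ a)

map-cong-range : ∀ {h g : ℕ → ℕ} a b → (∀ x → a ≤ x → x ≤ b → h x ≡ g x) →
                 map h (range a b) ≡ map g (range a b)
map-cong-range a b h≗g rewrite range-upFrom a b =
  map-cong-upFrom a _ (λ x a≤x x<a+k → h≗g x a≤x (upFrom-range-bound a≤x x<a+k))

countB-cong-range : ∀ {f g : ℕ → Bool} a b → (∀ x → a ≤ x → x ≤ b → f x ≡ g x) →
                    countB f (range a b) ≡ countB g (range a b)
countB-cong-range a b f≗g = cong sum (map-cong-range a b (λ x a≤x x≤b → cong ind (f≗g x a≤x x≤b)))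

countB-none : ∀ {f : ℕ → Bool} xs → (∀ x → f x ≡ false) → countB f xs ≡ 0
countB-none []       _ = refl
countB-none (x ∷ xs) none rewrite none x = countB-none xs none

countB-none-upFrom : ∀ {f : ℕ → Bool} c k → (∀ x → c ≤ x → f x ≡ false) → countB f (upFrom c k) ≡ 0
countB-none-upFrom c zero    none = refl
countB-none-upFrom c (suc k) none rewrite none c ≤-refl =
  countB-none-upFrom (suc c) k (λ x c<x → none x (<⇒≤ c<x))

countB-∷ʳ : ∀ (f : ℕ → Bool) xs x → countB f (xs ∷ʳ x) ≡ countB f xs + (ind (f x) + 0)
countB-∷ʳ f xs x =
  trans (cong sum (map-++ (λ y → ind (f y)) xs (x ∷ []))) (sum-++ (map (λ y → ind (f y)) xs) _)

sum-map-+ : ∀ {f g : ℕ → ℕ} xs → sum (map (λ x → f x + g x) xs) ≡ sum (map f xs) + sum (map g xs)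
sum-map-+ []                = refl
sum-map-+ {f} {g} (x ∷ xs) = trans (cong (f x + g x +_) (sum-map-+ xs)) (interchange (f x) (g x) _ _)

countB-split-range : ∀ {f g h : ℕ → Bool} a b → (∀ x → a ≤ x → x ≤ b → ind (f x) ≡ ind (g x) + ind (h x)) →
                     countB f (range a b) ≡ countB g (range a b) + countB h (range a b)
countB-split-range a b split = trans (cong sum (map-cong-range a b split)) (sum-map-+ (range a b))

countB-≡ᵇ-upFrom : ∀ c k x → c ≤ x → x < c + k → countB (x ≡ᵇ_) (upFrom c k) ≡ 1
countB-≡ᵇ-upFrom c zero    x c≤x x<c+0 = contradiction (subst (x <_) (+-identityʳ c) x<c+0) (≤⇒≯ c≤x)
countB-≡ᵇ-upFrom c (suc k) x c≤x x<c+k with m≤n⇒m<n∨m≡n c≤x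
... | inj₂ refl rewrite ≡ᵇ-true (refl {x = c}) =
  cong suc (countB-none-upFrom (suc c) k (λ y c<y → ≡ᵇ-false (λ c≡y → <⇒≢ c<y c≡y)))
... | inj₁ c<x rewrite ≡ᵇ-false (λ x≡c → <⇒≢ c<x (sym x≡c)) =
  countB-≡ᵇ-upFrom (suc c) k x c<x (subst (x <_) (+-suc c k) x<c+k)

reverse-upFrom-suc : ∀ c k → reverse (upFrom c (suc k)) ≡ (c + k) ∷ reverse (upFrom c k)
reverse-upFrom-suc c k = trans (cong reverse (upFrom-∷ʳ c k)) (reverse-++ (upFrom c k) (c + k ∷ []))

Reflected : (ℕ → ℕ) → (ℕ → ℕ) → ℕ → ℕ → ℕ → Set
Reflected h g σ a k = ∀ i j → i + j ≡ σ → a ≤ j → j < a + k → h j ≡ g i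

map-upFrom-reflect : ∀ {h g : ℕ → ℕ} k a c σ → a + (c + k) ≡ suc σ →
  map h (upFrom a k) ≡ map g (reverse (upFrom c k)) ⇔ Reflected h g σ a k
map-upFrom-reflect zero a c σ _ =
  mk⇔ (λ _ i j _ a≤j j<a+0 → contradiction (subst (j <_) (+-identityʳ a) j<a+0) (≤⇒≯ a≤j)) (λ _ → refl)
map-upFrom-reflect {h} {g} (suc k) a c σ sum≡ rewrite reverse-upFrom-suc c k = mk⇔ to from
  where
  sum≡′ : suc a + (c + k) ≡ suc σ
  sum≡′ = trans (sym (trans (cong (a +_) (+-suc c k)) (+-suc a (c + k)))) sum≡
  rest : map h (upFrom (suc a) k) ≡ map g (reverse (upFrom c k)) ⇔ Reflected h g σ (suc a) k
  rest = map-upFrom-reflect k (suc a) c σ sum≡′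
  head-index : ∀ i → i + a ≡ σ → i ≡ c + k
  head-index i i+a≡σ =
    +-cancelʳ-≡ a i (c + k) (trans i+a≡σ (trans (sym (suc-injective sum≡′)) (+-comm a (c + k))))
  to : h a ∷ map h (upFrom (suc a) k) ≡ g (c + k) ∷ map g (reverse (upFrom c k)) → Reflected h g σ a (suc k)
  to e i j i+j≡σ a≤j j<a+k with m≤n⇒m<n∨m≡n a≤j | ∷-injective e
  ... | inj₂ refl | h≡g , _ rewrite head-index i i+j≡σ = h≡g
  ... | inj₁ a<j  | _ , rest-eq = Equivalence.to rest rest-eq i j i+j≡σ a<j (subst (j <_) (+-suc a k) j<a+k)
  from : Reflected h g σ a (suc k) → h a ∷ map h (upFrom (suc a) k) ≡ g (c + k) ∷ map g (reverse (upFrom c k))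
  from H = cong₂ _∷_ (H (c + k) a (trans (+-comm (c + k) a) (suc-injective sum≡′)) ≤-refl (m<m+n a z<s))
    (Equivalence.from rest λ i j i+j≡σ a<j j<a+k →
      H i j i+j≡σ (<⇒≤ a<j) (subst (j <_) (sym (+-suc a k)) j<a+k))

[1+d]∸c≡[1+b]∸a : ∀ a b c d → a + d ≡ b + c → suc d ∸ c ≡ suc b ∸ a
[1+d]∸c≡[1+b]∸a a b c d a+d≡b+c = begin
  suc d ∸ c               ≡⟨ sym ([m+n]∸[m+o]≡n∸o a (suc d) c) ⟩
  a + suc d ∸ (a + c)     ≡⟨ cong (_∸ (a + c)) (trans (+-suc a d) (cong suc a+d≡b+c)) ⟩
  suc b + c ∸ (a + c)     ≡⟨ cong₂ _∸_ (+-comm (suc b) c) (+-comm a c) ⟩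
  c + suc b ∸ (c + a)     ≡⟨ [m+n]∸[m+o]≡n∸o c (suc b) a ⟩
  suc b ∸ a               ∎
  where open ≡-Reasoning

map-range-reflect : ∀ {h g : ℕ → ℕ} a b c d → a ≤ suc b → a + d ≡ b + c →
  map h (range a b) ≡ map g (reverse (range c d)) ⇔ (∀ i j → i + j ≡ b + c → a ≤ j → j ≤ b → h j ≡ g i)
map-range-reflect {h} {g} a b c d a≤1+b a+d≡b+c
  rewrite range-upFrom a b | range-upFrom c d | [1+d]∸c≡[1+b]∸a a b c d a+d≡b+c = mk⇔
    (λ e i j i+j≡σ a≤j j≤b → Equivalence.to reflect e i j i+j≡σ a≤j (subst (j <_) (sym a+k≡1+b) (s≤s j≤b)))
    (λ H → Equivalence.from reflect λ i j i+j≡σ a≤j j<a+k →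
      H i j i+j≡σ a≤j (≤-pred (subst (j <_) a+k≡1+b j<a+k)))
  where
  open ≡-Reasoning
  k : ℕ
  k = suc b ∸ a
  a+k≡1+b : a + k ≡ suc b
  a+k≡1+b = m+[n∸m]≡n a≤1+b
  reflect : map h (upFrom a k) ≡ map g (reverse (upFrom c k)) ⇔ Reflected h g (b + c) a k
  reflect = map-upFrom-reflect k a c (b + c) (begin
    a + (c + k)             ≡⟨ +-comm a (c + k) ⟩
    c + k + a               ≡⟨ +-assoc c k a ⟩
    c + (k + a)             ≡⟨ cong (c +_) (trans (+-comm k a) a+k≡1+b) ⟩
    c + suc b               ≡⟨ +-suc c b ⟩
    suc (c + b)             ≡⟨ cong suc (+-comm c b) ⟩
    suc (b + c)             ∎)

map-reverse-range-ends : ∀ (e : ℕ → ℕ) {k} → 1 ≤ k →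
  map e (reverse (range 1 (suc k))) ≡ (e (suc k) ∷ map e (reverse (range 2 k))) ++ e 1 ∷ []
map-reverse-range-ends e {k} 1≤k = begin
  map e (reverse (range 1 (suc k)))             ≡⟨ cong (map e ∘ reverse) (range-∷ {b = suc k} (s≤s z≤n)) ⟩
  map e (reverse (1 ∷ range 2 (suc k)))         ≡⟨ cong (map e ∘ reverse ∘ (1 ∷_)) (range-∷ʳ {b = k} (s≤s 1≤k)) ⟩
  map e (reverse (1 ∷ (range 2 k ∷ʳ suc k)))    ≡⟨ cong (map e) (unfold-reverse 1 (range 2 k ∷ʳ suc k)) ⟩
  map e (reverse (range 2 k ∷ʳ suc k) ∷ʳ 1)     ≡⟨ cong (λ xs → map e (xs ∷ʳ 1)) (reverse-++ (range 2 k) (suc k ∷ [])) ⟩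
  map e ((suc k ∷ reverse (range 2 k)) ∷ʳ 1)    ≡⟨ map-++ e (suc k ∷ reverse (range 2 k)) (1 ∷ []) ⟩
  (e (suc k) ∷ map e (reverse (range 2 k))) ++ e 1 ∷ []  ∎
  where open ≡-Reasoning

countB-≡ᵇ-range : ∀ {a b x} → a ≤ x → x ≤ b → countB (x ≡ᵇ_) (range a b) ≡ 1
countB-≡ᵇ-range {a} {b} {x} a≤x x≤b rewrite range-upFrom a b =
  countB-≡ᵇ-upFrom a (suc b ∸ a) x a≤x
    (subst (x <_) (sym (m+[n∸m]≡n (m≤n⇒m≤1+n (≤-trans a≤x x≤b)))) (s≤s x≤b))

countB-∧ʳ : ∀ {f : ℕ → Bool} c xs → countB f xs ≡ 1 → countB (λ x → f x ∧ c) xs ≡ ind c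
countB-∧ʳ {f} true  xs one = trans (cong sum (map-cong (λ x → cong ind (∧-identityʳ (f x))) xs)) one
countB-∧ʳ {f} false xs _   = countB-none xs (λ x → ∧-zeroʳ (f x))

≤pred⇒< : ∀ {a j} → 1 ≤ a → a ≤ j ∸ 1 → a < j
≤pred⇒< {j = zero}  1≤a a≤0 = contradiction a≤0 (<⇒≱ 1≤a)
≤pred⇒< {j = suc j} _   a≤j = s≤s a≤j

-- Defs builds expList and fromExps from helpers it keeps private. The first components
-- below are metas that unification solves with those helpers (abstracting 0 ∷ [] makes
-- the problem a pattern); runsFrom, decrHead and segments restate them.
private
  expListAcc : Σ (List ℕ → Path → List ℕ) λ G → ∀ w → G (0 ∷ []) w ≡ expList (N ∷ w)
  expListAcc = G , unify
    where
    G : List ℕ → Path → List ℕ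
    G = _
    unify : ∀ w → G (0 ∷ []) w ≡ expList (N ∷ w)
    unify w with List ℕ ∋ 0 ∷ []
    ... | _ = refl

  fromExpsAcc : Σ (List ℕ → Path) λ M → ∀ xs → fromExps xs ≡ M xs ++ E ∷ []
  fromExpsAcc = _ , λ xs → refl

runsFrom : List ℕ → Path → List ℕ
runsFrom ns       []      = ns
runsFrom ns       (N ∷ w) = runsFrom (0 ∷ ns) w
runsFrom []       (E ∷ w) = runsFrom [] w
runsFrom (k ∷ ns) (E ∷ w) = runsFrom (suc k ∷ ns) w

decrHead : List ℕ → List ℕ
decrHead []       = []
decrHead (k ∷ ks) = (k ∸ 1) ∷ ks

segments : List ℕ → Path
segments []       = []
segments (x ∷ xs) = segments xs ++ N ∷ replicate x E

expList-runsFrom : ∀ P → expList P ≡ decrHead (runsFrom [] P)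
expList-runsFrom []      = refl
expList-runsFrom (N ∷ w) = trans (sym (proj₂ expListAcc w)) (expListAcc-runsFrom (0 ∷ []) w)
  where
  expListAcc-runsFrom : ∀ ns w → proj₁ expListAcc ns w ≡ decrHead (runsFrom ns w)
  expListAcc-runsFrom []       []      = refl
  expListAcc-runsFrom (k ∷ ns) []      = refl
  expListAcc-runsFrom ns       (N ∷ w) = expListAcc-runsFrom (0 ∷ ns) w
  expListAcc-runsFrom []       (E ∷ w) = expListAcc-runsFrom [] w
  expListAcc-runsFrom (k ∷ ns) (E ∷ w) = expListAcc-runsFrom (suc k ∷ ns) w
expList-runsFrom (E ∷ w) = expList-runsFrom w

fromExps-segments : ∀ xs → fromExps xs ≡ segments xs ++ E ∷ []
fromExps-segments xs = trans (proj₂ fromExpsAcc xs) (cong (_++ E ∷ []) (fromExpsAcc-segments xs))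
  where
  fromExpsAcc-segments : ∀ xs → proj₁ fromExpsAcc xs ≡ segments xs
  fromExpsAcc-segments []       = refl
  fromExpsAcc-segments (x ∷ xs) = cong (_++ N ∷ replicate x E) (fromExpsAcc-segments xs)

runsFrom-++ : ∀ ns u v → runsFrom ns (u ++ v) ≡ runsFrom (runsFrom ns u) v
runsFrom-++ ns       []      v = refl
runsFrom-++ ns       (N ∷ u) v = runsFrom-++ (0 ∷ ns) u v
runsFrom-++ []       (E ∷ u) v = runsFrom-++ [] u v
runsFrom-++ (k ∷ ns) (E ∷ u) v = runsFrom-++ (suc k ∷ ns) u v

runsFrom-Es : ∀ k ns e → runsFrom (k ∷ ns) (replicate e E) ≡ (k + e) ∷ ns
runsFrom-Es k ns zero    = cong (_∷ ns) (sym (+-identityʳ k))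
runsFrom-Es k ns (suc e) = trans (runsFrom-Es (suc k) ns e) (cong (_∷ ns) (sym (+-suc k e)))

runsFrom-lastRun : ∀ ns X e → runsFrom ns (X ++ N ∷ replicate e E) ≡ e ∷ runsFrom ns X
runsFrom-lastRun ns X e = trans (runsFrom-++ ns X (N ∷ replicate e E)) (runsFrom-Es 0 (runsFrom ns X) e)

runsFrom-segments : ∀ ns xs → runsFrom ns (segments xs) ≡ xs ++ ns
runsFrom-segments ns []       = refl
runsFrom-segments ns (x ∷ xs) =
  trans (runsFrom-lastRun ns (segments xs) x) (cong (x ∷_) (runsFrom-segments ns xs))

expList-fromExps : ∀ xs → expList (fromExps xs) ≡ xs
expList-fromExps xs rewrite fromExps-segments xs | expList-runsFrom (segments xs ++ E ∷ [])
                          | runsFrom-++ [] (segments xs) (E ∷ []) | runsFrom-segments [] xs = final-E xs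
  where
  final-E : ∀ ys → decrHead (runsFrom (ys ++ []) (E ∷ [])) ≡ ys
  final-E []       = refl
  final-E (y ∷ ys) = cong (y ∷_) (++-identityʳ ys)

length-runsFrom : ∀ ns w → length (runsFrom ns w) ≡ length ns + countN w
length-runsFrom ns       []      = sym (+-identityʳ _)
length-runsFrom ns       (N ∷ w) = trans (length-runsFrom (0 ∷ ns) w) (sym (+-suc (length ns) (countN w)))
length-runsFrom []       (E ∷ w) = length-runsFrom [] w
length-runsFrom (k ∷ ns) (E ∷ w) = length-runsFrom (suc k ∷ ns) w

length-expList : ∀ P → length (expList P) ≡ countN P
length-expList P rewrite expList-runsFrom P = trans (length-decrHead (runsFrom [] P)) (length-runsFrom [] P)
  where
  length-decrHead : ∀ ks → length (decrHead ks) ≡ length ks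
  length-decrHead []       = refl
  length-decrHead (k ∷ ks) = refl

getIdx-beyond : ∀ xs {i} → length xs < i → getIdx xs i ≡ 0
getIdx-beyond []       {zero}        _         = refl
getIdx-beyond []       {suc i}       _         = refl
getIdx-beyond (x ∷ xs) {suc (suc i)} (s≤s len<i) = getIdx-beyond xs len<i

pE-beyond : ∀ P {i} → countN P < i → pE P i ≡ 0
pE-beyond P {i} #N<i = getIdx-beyond (expList P) (subst (_< i) (sym (length-expList P)) #N<i)

getIdx-map-upFrom : ∀ (f : ℕ → ℕ) c k i → i < k → getIdx (map f (upFrom c k)) (suc i) ≡ f (c + i)
getIdx-map-upFrom f c (suc k) zero    _         = cong f (sym (+-identityʳ c))
getIdx-map-upFrom f c (suc k) (suc i) (s≤s i<k) =
  trans (getIdx-map-upFrom f (suc c) k i i<k) (cong f (sym (+-suc c i)))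

pE-fromExps-range : ∀ (f : ℕ → ℕ) k {i} → 1 ≤ i → i ≤ k → pE (fromExps (map f (range 1 k))) i ≡ f i
pE-fromExps-range f k {suc i} _ i<k rewrite expList-fromExps (map f (range 1 k)) | range-upFrom 1 k =
  getIdx-map-upFrom f 1 k i i<k

pE-fromExps-beyond : ∀ xs {i} → length xs < i → pE (fromExps xs) i ≡ 0
pE-fromExps-beyond xs {i} len<i rewrite expList-fromExps xs = getIdx-beyond xs len<i

data LastRun : Path → Set where
  noN : ∀ e → LastRun (replicate e E)
  run : ∀ X e → LastRun (X ++ N ∷ replicate e E)

lastRun : ∀ W → LastRun W
lastRun []      = noN 0
lastRun (N ∷ W) with lastRun W
... | noN e   = run [] e
... | run X e = run (N ∷ X) e
lastRun (E ∷ W) with lastRun W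
... | noN e   = noN (suc e)
... | run X e = run (E ∷ X) e

pE-lastRun-1 : ∀ X e → pE (X ++ N ∷ replicate e E) 1 ≡ e ∸ 1
pE-lastRun-1 X e rewrite expList-runsFrom (X ++ N ∷ replicate e E) | runsFrom-lastRun [] X e = refl

pE-lastRun-2 : ∀ Y e f → pE ((Y ++ N ∷ replicate e E) ++ N ∷ replicate f E) 2 ≡ e
pE-lastRun-2 Y e f rewrite expList-runsFrom ((Y ++ N ∷ replicate e E) ++ N ∷ replicate f E)
  | runsFrom-lastRun [] (Y ++ N ∷ replicate e E) f | runsFrom-lastRun [] Y e = refl

countN-++ : ∀ X Y → countN (X ++ Y) ≡ countN X + countN Y
countN-++ []      Y = refl
countN-++ (N ∷ X) Y = cong suc (countN-++ X Y)
countN-++ (E ∷ X) Y = countN-++ X Y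

countE-++ : ∀ X Y → countE (X ++ Y) ≡ countE X + countE Y
countE-++ []      Y = refl
countE-++ (N ∷ X) Y = countE-++ X Y
countE-++ (E ∷ X) Y = cong suc (countE-++ X Y)

countN-Es : ∀ e → countN (replicate e E) ≡ 0
countN-Es zero    = refl
countN-Es (suc e) = countN-Es e

countN-++NE : ∀ X → countN (X ++ N ∷ E ∷ []) ≡ suc (countN X)
countN-++NE X = trans (countN-++ X (N ∷ E ∷ [])) (+-comm (countN X) 1)

length-counts : ∀ W → length W ≡ countN W + countE W
length-counts []      = refl
length-counts (N ∷ W) = cong suc (length-counts W)
length-counts (E ∷ W) = trans (cong suc (length-counts W)) (sym (+-suc (countN W) (countE W)))

take-length-++ : ∀ (X Y : Path) → take (length X) (X ++ Y) ≡ X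
take-length-++ []      Y = refl
take-length-++ (x ∷ X) Y = cong (x ∷_) (take-length-++ X Y)

dyck-suffix : ∀ {m} Y Z → IsDyck m (Y ++ Z) → countN Z ≤ countE Z
dyck-suffix Y Z (#N , #E , prefix) = +-cancelˡ-≤ (countE Y) (countN Z) (countE Z) (begin
  countE Y + countN Z   ≤⟨ +-monoˡ-≤ (countN Z) prefixY ⟩
  countN Y + countN Z   ≡⟨ sym (countN-++ Y Z) ⟩
  countN (Y ++ Z)       ≡⟨ trans #N (sym #E) ⟩
  countE (Y ++ Z)       ≡⟨ countE-++ Y Z ⟩
  countE Y + countE Z   ∎)
  where
  open ≤-Reasoning
  prefixY : countE Y ≤ countN Y
  prefixY = subst (λ W → countE W ≤ countN W) (take-length-++ Y Z) (prefix (length Y))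

dyck-lastRun-pos : ∀ {m} X e → IsDyck m (X ++ N ∷ replicate e E) → 1 ≤ e
dyck-lastRun-pos X zero    dX with () ← dyck-suffix X (N ∷ []) dX
dyck-lastRun-pos X (suc e) _  = s≤s z≤n

dyck-ends-NE : ∀ {m} P → IsDyck m P → 1 ≤ m → pE P 1 ≡ 0 → Σ[ X ∈ Path ] P ≡ X ++ N ∷ E ∷ []
dyck-ends-NE P dP 1≤m p₁≡0 with lastRun P
... | noN e = contradiction (trans (sym (proj₁ dP)) (countN-Es e)) (≢-sym (<⇒≢ 1≤m))
... | run X e = X , cong (λ e → X ++ N ∷ replicate e E) e≡1
  where
  e≡1 : e ≡ 1
  e≡1 = ≤-antisym (m∸n≡0⇒m≤n (trans (sym (pE-lastRun-1 X e)) p₁≡0)) (dyck-lastRun-pos X e dP)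

dyck-p₂-pos : ∀ {m} X → IsDyck m (X ++ N ∷ E ∷ []) → 2 ≤ m → 1 ≤ pE (X ++ N ∷ E ∷ []) 2
dyck-p₂-pos X dX 2≤m with lastRun X
... | noN e = contradiction (trans (sym (proj₁ dX)) (trans (countN-++NE (replicate e E)) (cong suc (countN-Es e))))
                            (≢-sym (<⇒≢ 2≤m))
... | run Y zero with s≤s () ← dyck-suffix Y (N ∷ N ∷ E ∷ [])
                                 (subst (IsDyck _) (++-assoc Y (N ∷ []) (N ∷ E ∷ [])) dX)
... | run Y (suc e) = subst (1 ≤_) (sym (pE-lastRun-2 Y (suc e) 1)) (s≤s z≤n)

pair-not-ending-EE : ∀ {m} X Q₁ → ¬ IsDyckPair m (X ++ N ∷ E ∷ []) (Q₁ ++ E ∷ E ∷ [])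
pair-not-ending-EE X Q₁ ((#NP , #EP , _) , (#NQ , #EQ , _) , below) = 1+n≰n (begin
  suc (countN X)                ≡⟨ sym (countN-++NE X) ⟩
  countN P                      ≡⟨ trans #NP (sym #NQ) ⟩
  countN Q                      ≡⟨ trans (countN-++ Q₁ (E ∷ E ∷ [])) (+-identityʳ (countN Q₁)) ⟩
  countN Q₁                     ≡⟨ cong countN (sym (take-length-++ Q₁ (E ∷ E ∷ []))) ⟩
  countN (take (length Q₁) Q)   ≡⟨ cong (λ k → countN (take k Q)) (sym |X|≡|Q₁|) ⟩
  countN (take (length X) Q)    ≤⟨ below (length X) ⟩
  countN (take (length X) P)    ≡⟨ cong countN (take-length-++ X (N ∷ E ∷ [])) ⟩
  countN X                      ∎)
  where
  open ≤-Reasoning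
  P Q : Path
  P = X ++ N ∷ E ∷ []
  Q = Q₁ ++ E ∷ E ∷ []
  |X|≡|Q₁| : length X ≡ length Q₁
  |X|≡|Q₁| = +-cancelʳ-≡ 2 (length X) (length Q₁) (begin-equality
    length X + 2            ≡⟨ sym (length-++ X) ⟩
    length P                ≡⟨ length-counts P ⟩
    countN P + countE P     ≡⟨ cong₂ _+_ (trans #NP (sym #NQ)) (trans #EP (sym #EQ)) ⟩
    countN Q + countE Q     ≡⟨ sym (length-counts Q) ⟩
    length Q                ≡⟨ length-++ Q₁ ⟩
    length Q₁ + 2           ∎)

pair-ends-NE : ∀ {m} X Q → IsDyckPair m (X ++ N ∷ E ∷ []) Q → Σ[ Y ∈ Path ] Q ≡ Y ++ N ∷ E ∷ []
pair-ends-NE X Q (dP , dQ , below) with lastRun Q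
... | noN e = contradiction (trans (sym (countN-Es e)) (trans (proj₁ dQ) (trans (sym (proj₁ dP)) (countN-++NE X))))
                            0≢1+n
... | run Y zero with () ← dyck-lastRun-pos Y zero dQ
... | run Y (suc zero) = Y , refl
... | run Y (suc (suc f)) =
  contradiction (subst (IsDyckPair _ _) Q≡Q₁++EE (dP , dQ , below)) (pair-not-ending-EE X (Y ++ N ∷ replicate f E))
  where
  replicate-2+ : ∀ f → replicate (2 + f) E ≡ replicate f E ++ E ∷ E ∷ []
  replicate-2+ zero    = refl
  replicate-2+ (suc f) = cong (E ∷_) (replicate-2+ f)
  Q≡Q₁++EE : Y ++ N ∷ replicate (2 + f) E ≡ (Y ++ N ∷ replicate f E) ++ E ∷ E ∷ []
  Q≡Q₁++EE = trans (cong (λ W → Y ++ N ∷ W) (replicate-2+ f)) (sym (++-assoc Y (N ∷ replicate f E) (E ∷ E ∷ [])))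

p₁≡0⇒p₂q₂-pos : ∀ {m} P Q → IsDyckPair m P Q → 2 ≤ m → pE P 1 ≡ 0 → (1 ≤ pE P 2) × (1 ≤ pE Q 2)
p₁≡0⇒p₂q₂-pos P Q dPQ@(dP , dQ , _) 2≤m p₁≡0 with dyck-ends-NE P dP (≤-trans (s≤s z≤n) 2≤m) p₁≡0
... | X , refl with pair-ends-NE X Q dPQ
... | Y , refl = dyck-p₂-pos X dP 2≤m , dyck-p₂-pos Y dQ 2≤m

-- p′ and q′ of π(P, Q) for a given s: piP m P Q is definitionally
-- fromExps (map (piExpP (sIdx m P Q) P) (range 1 (m ∸ 1))), and likewise for piQ.
piExpP : ℕ → Path → ℕ → ℕ
piExpP s P i = if i ≤ᵇ s ∸ 2 then pE P i
               else (if i ≡ᵇ s ∸ 1 then pE P (s ∸ 1) ∸ 1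
               else (if i ≡ᵇ s then pE P s + pE P (suc s)
               else pE P (suc i)))

piExpQ : ℕ → Path → ℕ → ℕ
piExpQ s Q i = if i ≤ᵇ s ∸ 2 then pE Q i
               else (if i ≡ᵇ s ∸ 1 then (pE Q (s ∸ 1) + pE Q s) ∸ 1
               else pE Q (suc i))

piExpP-above : ∀ s P {i} → s < i → piExpP s P i ≡ pE P (suc i)
piExpP-above s P {i} s<i
  rewrite ≤ᵇ-false {i} {s ∸ 2} (≤-<-trans (m∸n≤m s 2) s<i)
        | ≡ᵇ-false {i} {s ∸ 1} (λ i≡ → <⇒≱ s<i (≤-trans (≤-reflexive i≡) (m∸n≤m s 1)))
        | ≡ᵇ-false {i} {s} (λ i≡s → <⇒≢ s<i (sym i≡s)) = refl

piExpQ-above : ∀ s Q {i} → 1 ≤ s → s ≤ i → piExpQ s Q i ≡ pE Q (suc i)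
piExpQ-above (suc s) Q {i} _ s<i
  rewrite ≤ᵇ-false {i} {suc s ∸ 2} (<-≤-trans (s≤s (m∸n≤m s 1)) s<i)
        | ≡ᵇ-false {i} {s} (λ i≡s → <⇒≢ s<i (sym i≡s)) = refl

2≤sIdx : ∀ m P Q → 2 ≤ sIdx m P Q
2≤sIdx m P Q = findMinFrom-≥ _ 2 m

sIdx≤1+m : ∀ m P Q → 1 ≤ m → pE P (suc m) ≡ 0 → sIdx m P Q ≤ suc m
sIdx≤1+m m P Q 1≤m p≡0 = findMinFrom-minimal _ 2 m (cong (λ p → p * pE Q (suc m) ≡ᵇ 0) p≡0) (s≤s 1≤m) ≤-refl

sIdx≡2⇒p₂q₂≡0 : ∀ m P Q → 1 ≤ m → sIdx m P Q ≡ 2 → pE P 2 * pE Q 2 ≡ 0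
sIdx≡2⇒p₂q₂≡0 m P Q 1≤m s≡2 = ≡ᵇ-sound (subst (λ s → (pE P s * pE Q s ≡ᵇ 0) ≡ true) s≡2 holds)
  where
  holds : (pE P (sIdx m P Q) * pE Q (sIdx m P Q) ≡ᵇ 0) ≡ true
  holds = findMinFrom-holds (λ j → pE P j * pE Q j ≡ᵇ 0) 2 m (subst (_< 2 + m) (sym s≡2) (+-monoʳ-< 2 1≤m))

pE-fromExps-shift : ∀ (f : ℕ → ℕ) k W {i} → countN W ≤ suc k → 1 ≤ i → (i ≤ k → f i ≡ pE W (suc i)) →
                    pE (fromExps (map f (range 1 k))) i ≡ pE W (suc i)
pE-fromExps-shift f k W {i} #N≤1+k 1≤i shift with i ≤? k
... | yes i≤k = trans (pE-fromExps-range f k 1≤i i≤k) (shift i≤k)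
... | no  i≰k = trans (pE-fromExps-beyond (map f (range 1 k)) (subst (_< i) (sym length≡k) (≰⇒> i≰k)))
                      (sym (pE-beyond W (≤-<-trans #N≤1+k (s≤s (≰⇒> i≰k)))))
  where
  length≡k : length (map f (range 1 k)) ≡ k
  length≡k = trans (length-map f (range 1 k)) (length-range 1 k)

pE-piP-above : ∀ {m} P Q {i} → countN P ≡ m → sIdx m P Q < i → pE (piP m P Q) i ≡ pE P (suc i)
pE-piP-above {m} P Q #N s<i = pE-fromExps-shift (piExpP (sIdx m P Q) P) (m ∸ 1) P
  (subst (_≤ suc (m ∸ 1)) (sym #N) (m≤n+m∸n m 1)) (≤-trans (s≤s z≤n) s<i) (λ _ → piExpP-above _ P s<i)

pE-piQ-above : ∀ {m} P Q {i} → countN Q ≡ m → sIdx m P Q ≤ i → pE (piQ m P Q) i ≡ pE Q (suc i)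
pE-piQ-above {m} P Q #N s≤i = pE-fromExps-shift (piExpQ (sIdx m P Q) Q) (m ∸ 1) Q
  (subst (_≤ suc (m ∸ 1)) (sym #N) (m≤n+m∸n m 1)) (≤-trans 1≤s s≤i) (λ _ → piExpQ-above _ Q 1≤s s≤i)
  where
  1≤s : 1 ≤ sIdx m P Q
  1≤s = ≤-trans (s≤s z≤n) (2≤sIdx m P Q)

piExpP-1 : ∀ s P → 2 ≤ s → (s ≡ 2 → 1 ≤ pE P 1) → piExpP s P 1 + ind (s ≡ᵇ 2) ≡ pE P 1
piExpP-1 (suc (suc zero))    P _ 1≤p₁ = m∸n+n≡m (1≤p₁ refl)
piExpP-1 (suc (suc (suc s))) P _ _    = +-identityʳ (pE P 1)
piExpP-1 (suc zero)          P (s≤s ()) _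

sIdx≡2⇒1≤p₁ : ∀ {m} P Q → IsDyckPair m P Q → 2 ≤ m → sIdx m P Q ≡ 2 → 1 ≤ pE P 1
sIdx≡2⇒1≤p₁ {m} P Q dPQ 2≤m s≡2 with pE P 1 ≟ 0
... | no p₁≢0 = n≢0⇒n>0 p₁≢0
... | yes p₁≡0 with p₁≡0⇒p₂q₂-pos P Q dPQ 2≤m p₁≡0
                  | m*n≡0⇒m≡0∨n≡0 (pE P 2) (sIdx≡2⇒p₂q₂≡0 m P Q (≤-trans (s≤s z≤n) 2≤m) s≡2)
...   | 1≤p₂ , _ | inj₁ p₂≡0 = contradiction p₂≡0 (≢-sym (<⇒≢ 1≤p₂))
...   | _ , 1≤q₂ | inj₂ q₂≡0 = contradiction q₂≡0 (≢-sym (<⇒≢ 1≤q₂))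

pE-piP-1 : ∀ {m} P Q → IsDyckPair m P Q → 2 ≤ m → pE (piP m P Q) 1 + ind (sIdx m P Q ≡ᵇ 2) ≡ pE P 1
pE-piP-1 {m} P Q dPQ 2≤m = trans (cong (_+ ind (s ≡ᵇ 2)) p′₁≡)
  (piExpP-1 s P (2≤sIdx m P Q) (sIdx≡2⇒1≤p₁ P Q dPQ 2≤m))
  where
  s : ℕ
  s = sIdx m P Q
  p′₁≡ : pE (piP m P Q) 1 ≡ piExpP s P 1
  p′₁≡ = pE-fromExps-range (piExpP s P) (m ∸ 1) ≤-refl (m+n≤o⇒m≤o∸n 1 2≤m)

Nontrivial : ℕ → ℕ → ℕ → Set
Nontrivial n a b = 1 ≤ a × a + 3 ≤ b × b ≤ n × b + 3 ≤ a + n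

isNontrivial-reflects : ∀ n a b → Reflects (Nontrivial n a b) (isNontrivial n a b)
isNontrivial-reflects n a b = ≤ᵇ-reflects-≤ 1 a ×-reflects ≤ᵇ-reflects-≤ (a + 3) b
                                ×-reflects ≤ᵇ-reflects-≤ b n ×-reflects ≤ᵇ-reflects-≤ (b + 3) (a + n)

isTrivial-reflects : ∀ n a b → Reflects (1 ≤ a × b ≤ n × (a + 2 ≡ b ⊎ b + 2 ≡ a + n)) (isTrivial n a b)
isTrivial-reflects n a b = ≤ᵇ-reflects-≤ 1 a ×-reflects ≤ᵇ-reflects-≤ b n
                             ×-reflects (≡ᵇ-reflects-≡ (a + 2) b ⊎-reflects ≡ᵇ-reflects-≡ (b + 2) (a + n))

isDiag-ear : ∀ {n a} → 5 ≤ n → 1 ≤ a → a + 3 ≤ n → isDiag n a (a + 3) ≡ true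
isDiag-ear {n} {a} 5≤n 1≤a a+3≤n = reflects-true
  (≤ᵇ-reflects-≤ 1 a ×-reflects ≤ᵇ-reflects-≤ (a + 2) (a + 3) ×-reflects ≤ᵇ-reflects-≤ (a + 3) n
     ×-reflects ≤ᵇ-reflects-≤ (a + 3 + 2) (a + n))
  (1≤a , +-monoʳ-≤ a (n≤1+n 2) , a+3≤n , subst (_≤ a + n) (sym (+-assoc a 3 2)) (+-monoʳ-≤ a 5≤n))

isTrivial-ear : ∀ {n a} → 6 ≤ n → isTrivial n a (a + 3) ≡ false
isTrivial-ear {n} {a} 6≤n = reflects-false (isTrivial-reflects n a (a + 3)) λ where
  (_ , _ , inj₁ a+2≡a+3) → contradiction (+-cancelˡ-≡ a 2 3 a+2≡a+3) λ ()
  (_ , _ , inj₂ a+5≡a+n) → contradiction (+-cancelˡ-≡ a 5 n (trans (sym (+-assoc a 3 2)) a+5≡a+n)) (<⇒≢ 6≤n)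

addDiag-member : ∀ S {a b x y} → addDiag S a b x y ≡ true → S x y ≡ true ⊎ (x ≡ a × y ≡ b)
addDiag-member S {a} {b} {x} {y} x∈S+ab with S x y
... | true  = inj₁ refl
... | false = inj₂ (reflects-sound (≡ᵇ-reflects-≡ x a ×-reflects ≡ᵇ-reflects-≡ y b) x∈S+ab)

cross-irrefl : ∀ {a b} → ¬ Cross a b a b
cross-irrefl (inj₁ (a<a , _)) = <-irrefl refl a<a
cross-irrefl (inj₂ (a<a , _)) = <-irrefl refl a<a

cross-sym : ∀ {a b c d} → Cross a b c d → Cross c d a b
cross-sym (inj₁ c) = inj₂ c
cross-sym (inj₂ c) = inj₁ c

nothing-between : ∀ {x y} → x < y → y < suc x → ⊥
nothing-between x<y y<1+x = <⇒≱ x<y (≤-pred y<1+x)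

no-crossing-both-ears : ∀ {a u v} → Cross a (a + 3) u v → Cross (a + 2) (a + 4) u v → ⊥
no-crossing-both-ears {a} {u} (inj₁ (_ , u<a+3 , _)) (inj₁ (a+2<u , _)) =
  nothing-between a+2<u (subst (u <_) (+-suc a 2) u<a+3)
no-crossing-both-ears {a} {v = v} (inj₁ (_ , _ , a+3<v)) (inj₂ (_ , _ , v<a+4)) =
  nothing-between a+3<v (subst (v <_) (+-suc a 3) v<a+4)
no-crossing-both-ears {a} (inj₂ (u<a , _)) (inj₁ (a+2<u , _)) =
  <-asym u<a (≤-trans (s≤s (m≤m+n a 2)) a+2<u)
no-crossing-both-ears {a} {v = v} (inj₂ (_ , _ , v<a+3)) (inj₂ (_ , a+2<v , _)) =
  nothing-between a+2<v (subst (v <_) (+-suc a 2) v<a+3)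

module TwoTriangulation {n : ℕ} (6≤n : 6 ≤ n) {T : DiagSet} (tri : IsTwoTri n T) where

  S : DiagSet
  S a b = T a b ∨ isTrivial n a b

  1+[n∸1]≡n : 1 + (n ∸ 1) ≡ n
  1+[n∸1]≡n = m+[n∸m]≡n (≤-trans (s≤s z≤n) 6≤n)

  S-noThreeCrossing : NoThreeCrossing S
  S-noThreeCrossing = proj₁ (proj₂ (proj₂ tri))

  S-maximal : ∀ a b → isDiag n a b ≡ true → S a b ≡ false → ¬ NoThreeCrossing (addDiag S a b)
  S-maximal = proj₂ (proj₂ (proj₂ tri))

  T-nontrivial : ∀ {a b} → T a b ≡ true → Nontrivial n a b
  T-nontrivial {a} {b} t = reflects-sound (isNontrivial-reflects n a b) (proj₁ tri a b t)

  T⇒S : ∀ {a b} → T a b ≡ true → S a b ≡ true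
  T⇒S t rewrite t = refl

  T-backward : ∀ {a b} → a ≤ b → T b a ≡ false
  T-backward {a} {b} a≤b with T b a in t
  ... | false = refl
  ... | true  = contradiction (≤-trans (proj₁ (proj₂ (T-nontrivial t))) a≤b) (m+1+n≰m b)

  NoNested : ℕ → ℕ → Set
  NoNested a b = ∀ u v → T u v ≡ true → a < u → v ≤ b → ⊥

  data EarCrosser (a b u v : ℕ) : Set where
    nested   : T u v ≡ true → a < u → v ≤ b → EarCrosser a b u v
    crossing : Cross a b u v → EarCrosser a b u v
    next-ear : u ≡ a + 2 → v ≡ a + 4 → EarCrosser a b u v

  classify-ear-crosser : ∀ {a b u v} → a + 4 ≤ b → b + 3 ≤ a + n → S u v ≡ true → Cross a (a + 3) u v →
                         EarCrosser a b u v
  classify-ear-crosser {a} {b} {u} {v} a+4≤b _ _ (inj₂ (u<a , a<v , v<a+3)) =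
    crossing (inj₂ (u<a , a<v , <-≤-trans v<a+3 (≤-trans (+-monoʳ-≤ a (n≤1+n 3)) a+4≤b)))
  classify-ear-crosser {a} {b} {u} {v} a+4≤b b+3≤a+n uv∈S (inj₁ (a<u , u<a+3 , a+3<v)) with v ≤? b
  ... | no v≰b = crossing (inj₁ (a<u , <-≤-trans u<a+3 (≤-trans (+-monoʳ-≤ a (n≤1+n 3)) a+4≤b) , ≰⇒> v≰b))
  ... | yes v≤b with T u v in t
  ...   | true = nested t a<u v≤b
  ...   | false with reflects-sound (isTrivial-reflects n u v) uv∈S
  ...     | _ , _ , inj₁ u+2≡v = next-ear u≡a+2 (trans (sym u+2≡v) (trans (cong (_+ 2) u≡a+2) (+-assoc a 2 2)))
    where
    u≡a+2 : u ≡ a + 2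
    u≡a+2 = ≤-antisym (≤-pred (subst (u <_) (+-suc a 2) u<a+3))
      (+-cancelʳ-≤ 2 (a + 2) u (subst₂ _≤_ (sym (trans (+-assoc a 2 2) (+-suc a 3))) (sym u+2≡v) a+3<v))
  ...     | _ , _ , inj₂ v+2≡u+n = contradiction v+2≡u+n (<⇒≢ (begin-strict
    v + 2      ≤⟨ +-monoˡ-≤ 2 v≤b ⟩
    b + 2      <⟨ +-monoʳ-< b (n<1+n 2) ⟩
    b + 3      ≤⟨ b+3≤a+n ⟩
    a + n      <⟨ +-monoˡ-< n a<u ⟩
    u + n      ∎))
    where open ≤-Reasoning

  -- Adding the ear (a, a+3) creates no 3-crossing: two crossing diagonals of S that both
  -- cross the ear are neither nested in (a, b] nor the next ear (a+2, a+4), so both cross (a, b).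
  module _ {a b : ℕ} (ab∈T : T a b ≡ true) (a+4≤b : a + 4 ≤ b) (no-nested : NoNested a b) where

    no-crossing-pair-across-ear : ∀ u v w x → S u v ≡ true → S w x ≡ true →
      Cross a (a + 3) u v → Cross a (a + 3) w x → Cross u v w x → ⊥
    no-crossing-pair-across-ear u v w x uv∈S wx∈S ear×uv ear×wx uv×wx
      with classify-ear-crosser a+4≤b b+3≤a+n uv∈S ear×uv | classify-ear-crosser a+4≤b b+3≤a+n wx∈S ear×wx
      where
      b+3≤a+n : b + 3 ≤ a + n
      b+3≤a+n = proj₂ (proj₂ (proj₂ (T-nontrivial ab∈T)))
    ... | nested t a<u v≤b | _ = no-nested u v t a<u v≤b
    ... | _ | nested t a<w x≤b = no-nested w x t a<w x≤b
    ... | next-ear refl refl | _ = no-crossing-both-ears ear×wx uv×wx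
    ... | _ | next-ear refl refl = no-crossing-both-ears ear×uv (cross-sym uv×wx)
    ... | crossing ab×uv | crossing ab×wx = S-noThreeCrossing a b u v w x (T⇒S ab∈T) uv∈S wx∈S ab×uv ab×wx uv×wx

    ear-addable : NoThreeCrossing (addDiag S a (a + 3))
    ear-addable x₁ y₁ x₂ y₂ x₃ y₃ m₁ m₂ m₃ c₁₂ c₁₃ c₂₃
      with addDiag-member S m₁ | addDiag-member S m₂ | addDiag-member S m₃
    ... | inj₁ s₁ | inj₁ s₂ | inj₁ s₃ = S-noThreeCrossing x₁ y₁ x₂ y₂ x₃ y₃ s₁ s₂ s₃ c₁₂ c₁₃ c₂₃
    ... | inj₂ (refl , refl) | inj₁ s₂ | inj₁ s₃ = no-crossing-pair-across-ear x₂ y₂ x₃ y₃ s₂ s₃ c₁₂ c₁₃ c₂₃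
    ... | inj₁ s₁ | inj₂ (refl , refl) | inj₁ s₃ =
      no-crossing-pair-across-ear x₁ y₁ x₃ y₃ s₁ s₃ (cross-sym c₁₂) c₂₃ c₁₃
    ... | inj₁ s₁ | inj₁ s₂ | inj₂ (refl , refl) =
      no-crossing-pair-across-ear x₁ y₁ x₂ y₂ s₁ s₂ (cross-sym c₁₃) (cross-sym c₂₃) c₁₂
    ... | inj₂ (refl , refl) | inj₂ (refl , refl) | _ = cross-irrefl c₁₂
    ... | inj₂ (refl , refl) | inj₁ _ | inj₂ (refl , refl) = cross-irrefl c₁₃
    ... | inj₁ _ | inj₂ (refl , refl) | inj₂ (refl , refl) = cross-irrefl c₂₃

    ear-forced : T a (a + 3) ≡ true
    ear-forced with T a (a + 3) in ear
    ... | true  = refl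
    ... | false =
      contradiction ear-addable (S-maximal a (a + 3) (isDiag-ear (≤-trans (n≤1+n 5) 6≤n) 1≤a a+3≤n) ear∉S)
      where
      1≤a : 1 ≤ a
      1≤a = proj₁ (T-nontrivial ab∈T)
      a+3≤n : a + 3 ≤ n
      a+3≤n = ≤-trans (proj₁ (proj₂ (T-nontrivial ab∈T))) (proj₁ (proj₂ (proj₂ (T-nontrivial ab∈T))))
      ear∉S : S a (a + 3) ≡ false
      ear∉S rewrite ear = isTrivial-ear {a = a} 6≤n

  EarFree : ℕ → ℕ → Set
  EarFree a b = ∀ a′ → a ≤ a′ → a′ + 3 ≤ b → T a′ (a′ + 3) ≡ false

  diagonal-spans-ear : ∀ {a b} → T a b ≡ true → ¬ EarFree a b
  diagonal-spans-ear {a} {b} = go (<-wellFounded (b ∸ a))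
    where
    go : ∀ {a b} → Acc _<_ (b ∸ a) → T a b ≡ true → ¬ EarFree a b
    go {a} {b} (acc smaller) ab∈T earFree with m≤n⇒m<n∨m≡n (proj₁ (proj₂ (T-nontrivial ab∈T)))
    ... | inj₂ refl = contradiction (trans (sym ab∈T) (earFree a ≤-refl ≤-refl)) λ ()
    ... | inj₁ a+3<b =
      contradiction (trans (sym (ear-forced ab∈T a+4≤b no-nested)) (earFree a ≤-refl (<⇒≤ a+3<b))) λ ()
      where
      a+4≤b : a + 4 ≤ b
      a+4≤b = subst (_≤ b) (sym (+-suc a 3)) a+3<b
      no-nested : NoNested a b
      no-nested u v uv∈T a<u v≤b = go (smaller (begin-strict
          v ∸ u  ≤⟨ ∸-monoˡ-≤ u v≤b ⟩
          b ∸ u  <⟨ ∸-monoʳ-< a<u (≤-trans (m≤m+n u 3) (≤-trans (proj₁ (proj₂ (T-nontrivial uv∈T))) v≤b)) ⟩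
          b ∸ a  ∎))
        uv∈T (λ a′ u≤a′ a′+3≤v → earFree a′ (≤-trans (<⇒≤ a<u) u≤a′) (≤-trans a′+3≤v v≤b))
        where open ≤-Reasoning

  left-end≤rIdx : ∀ {a b} → T a b ≡ true → a ≤ rIdx n T
  left-end≤rIdx {a} {b} ab∈T with a ≤? rIdx n T
  ... | yes a≤r = a≤r
  ... | no  a≰r = ⊥-elim (diagonal-spans-ear ab∈T earFree)
    where
    earFree : EarFree a b
    earFree a′ a≤a′ a′+3≤b with T a′ (a′ + 3) in ear
    ... | false = refl
    ... | true  = contradiction (≤-trans a≤a′ (findMax-maximal (λ x → T x (x + 3)) (n ∸ 3) ear 1≤a′ a′≤n-3)) a≰r
      where
      1≤a′ : 1 ≤ a′
      1≤a′ = ≤-trans (proj₁ (T-nontrivial ab∈T)) a≤a′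
      a′≤n-3 : a′ ≤ n ∸ 3
      a′≤n-3 = m+n≤o⇒m≤o∸n a′ (≤-trans a′+3≤b (proj₁ (proj₂ (proj₂ (T-nontrivial ab∈T)))))

  rIdx+3≤n : rIdx n T + 3 ≤ n
  rIdx+3≤n = subst (rIdx n T + 3 ≤_) (m∸n+n≡m (≤-trans (≤-trans (n≤1+n 3) (n≤1+n 4)) (≤-trans (n≤1+n 5) 6≤n)))
                   (+-monoˡ-≤ 3 (findMax-≤ _ (n ∸ 3)))

  ear-at-rIdx : 1 ≤ rIdx n T → T (rIdx n T) (rIdx n T + 3) ≡ true
  ear-at-rIdx = findMax-holds (λ x → T x (x + 3)) (n ∸ 3)

  T-short : ∀ {a b} → b < a + 3 → T a b ≡ false
  T-short {a} {b} b<a+3 with T a b in ab∈T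
  ... | false = refl
  ... | true  = contradiction (proj₁ (proj₂ (T-nontrivial ab∈T))) (<⇒≱ b<a+3)

-- The where-block of parentT, with rIdx n T abstracted to r and its pieces named.
hasDiagonals : ℕ → DiagSet → ℕ → Bool
hasDiagonals n T v = not (deg n T v ≡ᵇ 0)

laterDeletions : ℕ → DiagSet → ℕ → List (ℕ × ℕ)
laterDeletions n T r =
  (if hasDiagonals n T (r + 1) then [] else ordPair (if r ≡ᵇ 1 then n else r ∸ 1) (r + 2) ∷ [])
  ++ (if hasDiagonals n T (r + 2) then [] else (1 , r + 1) ∷ [])
  ++ (if hasDiagonals n T (r + 1) ∧ hasDiagonals n T (r + 2)
      then (findMax (λ a → T a (r + 2)) (r ∸ 1) , r + 2) ∷ [] else [])

isDeleted : ℕ → DiagSet → ℕ → ℕ → ℕ → Bool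
isDeleted n T r a b = any (λ pr → (proj₁ pr ≡ᵇ a) ∧ (proj₂ pr ≡ᵇ b)) ((r , r + 3) ∷ laterDeletions n T r)

survives : ℕ → DiagSet → ℕ → DiagSet
survives n T r a b = T a b ∧ not (isDeleted n T r a b)

preimage : ℕ → ℕ → List ℕ
preimage r x = if x ≤ᵇ r then x ∷ []
               else (if x ≡ᵇ suc r then suc r ∷ r + 2 ∷ [] else suc x ∷ [])

contract : ℕ → DiagSet → ℕ → DiagSet
contract n T r a b = isNontrivial (n ∸ 1) a b ∧
  any (λ a′ → any (λ b′ → survives n T r a′ b′ ∨ survives n T r b′ a′) (preimage r b)) (preimage r a)

parentT-contract : ∀ n T a b → parentT n T a b ≡ contract n T (rIdx n T) a b
parentT-contract n T a b = refl

All-if : ∀ {A : Set} {P : A → Set} c {xs ys} → All P xs → All P ys → All P (if c then xs else ys)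
All-if true  Pxs _   = Pxs
All-if false _   Pys = Pys

any-none : ∀ {A : Set} (f : A → Bool) {xs} → All (λ x → f x ≡ false) xs → any f xs ≡ false
any-none f []         = refl
any-none f (fx ∷ fxs) rewrite fx = any-none f fxs

isDeleted-away : ∀ n T r {a b} → 2 ≤ r → b ≢ r + 1 → b ≢ r + 2 →
                 isDeleted n T r a b ≡ (r ≡ᵇ a) ∧ (r + 3 ≡ᵇ b)
isDeleted-away n T r {a} {b} 2≤r b≢r+1 b≢r+2 =
  trans (cong ((r ≡ᵇ a) ∧ (r + 3 ≡ᵇ b) ∨_) (any-none _ later-avoid)) (∨-identityʳ _)
  where
  ends-elsewhere : ∀ x y → y ≢ b → (x ≡ᵇ a) ∧ (y ≡ᵇ b) ≡ false
  ends-elsewhere x y y≢b rewrite ≡ᵇ-false y≢b = ∧-zeroʳ (x ≡ᵇ a)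
  later-avoid : All (λ pr → (proj₁ pr ≡ᵇ a) ∧ (proj₂ pr ≡ᵇ b) ≡ false) (laterDeletions n T r)
  later-avoid = ++⁺ (All-if (hasDiagonals n T (r + 1)) [] (ordPair-avoid ∷ []))
    (++⁺ (All-if (hasDiagonals n T (r + 2)) [] (ends-elsewhere 1 (r + 1) (b≢r+1 ∘ sym) ∷ []))
         (All-if (hasDiagonals n T (r + 1) ∧ hasDiagonals n T (r + 2))
                 (ends-elsewhere (findMax (λ x → T x (r + 2)) (r ∸ 1)) (r + 2) (b≢r+2 ∘ sym) ∷ []) []))
    where
    ordPair-avoid : (proj₁ (ordPair (if r ≡ᵇ 1 then n else r ∸ 1) (r + 2)) ≡ᵇ a) ∧
                    (proj₂ (ordPair (if r ≡ᵇ 1 then n else r ∸ 1) (r + 2)) ≡ᵇ b) ≡ false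
    ordPair-avoid rewrite ≡ᵇ-false {r} {1} (λ r≡1 → <⇒≢ 2≤r (sym r≡1))
                        | ≤ᵇ-true (≤-trans (m∸n≤m r 1) (m≤m+n r 2)) =
      ends-elsewhere (r ∸ 1) (r + 2) (b≢r+2 ∘ sym)

preimage-≤ : ∀ {r x} → x ≤ r → preimage r x ≡ x ∷ []
preimage-≤ x≤r rewrite ≤ᵇ-true x≤r = refl

preimage-beyond : ∀ {r x} → suc r < x → preimage r x ≡ suc x ∷ []
preimage-beyond {r} {x} r+1<x
  rewrite ≤ᵇ-false (<-trans (n<1+n r) r+1<x) | ≡ᵇ-false (≢-sym (<⇒≢ r+1<x)) = refl

preimage-next : ∀ r → preimage r (suc r) ≡ suc r ∷ r + 2 ∷ []
preimage-next r rewrite ≤ᵇ-false (n<1+n r) | ≡ᵇ-true (refl {x = suc r}) = refl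

module ParentTriangulation {n : ℕ} (6≤n : 6 ≤ n) {T : DiagSet} (tri : IsTwoTri n T) (2≤r : 2 ≤ rIdx n T) where

  open TwoTriangulation 6≤n tri

  r : ℕ
  r = rIdx n T

  survives-backward : ∀ {a b} → a ≤ b → survives n T r b a ≡ false
  survives-backward a≤b rewrite T-backward a≤b = refl

  contract-singletons : ∀ {a b a′ b′} → preimage r a ≡ a′ ∷ [] → preimage r b ≡ b′ ∷ [] → a′ ≤ b′ →
                        contract n T r a b ≡ isNontrivial (n ∸ 1) a b ∧ survives n T r a′ b′
  contract-singletons {a} {b} {a′} {b′} pa pb a′≤b′ rewrite pa | pb | survives-backward a′≤b′ =
    cong (isNontrivial (n ∸ 1) a b ∧_) (trans (∨-identityʳ _) (trans (∨-identityʳ _) (∨-identityʳ _)))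

  r+3≤n : r + 3 ≤ n
  r+3≤n = rIdx+3≤n

  r+k≤n : ∀ k → k ≤ 3 → r + k ≤ n
  r+k≤n k k≤3 = ≤-trans (+-monoʳ-≤ r k≤3) r+3≤n

  2≤n : 2 ≤ n
  2≤n = ≤-trans (m≤n+m 2 r) (r+k≤n 2 (n≤1+n 2))

  survives-away : ∀ {a b} → b ≢ r + 1 → b ≢ r + 2 → survives n T r a b ≡ T a b ∧ not ((r ≡ᵇ a) ∧ (r + 3 ≡ᵇ b))
  survives-away {a} {b} b≢r+1 b≢r+2 = cong (λ d → T a b ∧ not d) (isDeleted-away n T r 2≤r b≢r+1 b≢r+2)

  survives-below : ∀ {a b} → b ≤ r → survives n T r a b ≡ T a b
  survives-below {a} {b} b≤r = trans (survives-away (below 0) (below 1))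
    (trans (cong (λ d → T a b ∧ not d) (trans (cong ((r ≡ᵇ a) ∧_) (≡ᵇ-false (≢-sym (below 2)))) (∧-zeroʳ _)))
           (∧-identityʳ (T a b)))
    where
    below : ∀ k → b ≢ r + suc k
    below k b≡ = <⇒≢ (s≤s (≤-trans b≤r (m≤m+n r k))) (trans b≡ (+-suc r k))

  parent-below : ∀ {a b} → a < b → b ≤ r → parentT n T a b ≡ T a b
  parent-below {a} {b} a<b b≤r =
    trans (contract-singletons {a} {b} (preimage-≤ (≤-trans (<⇒≤ a<b) b≤r)) (preimage-≤ b≤r) (<⇒≤ a<b))
          (trans (cong (isNontrivial (n ∸ 1) a b ∧_) (survives-below b≤r)) (∧-redundantˡ nontrivial))
    where
    open ≤-Reasoning
    nontrivial : T a b ≡ true → isNontrivial (n ∸ 1) a b ≡ true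
    nontrivial ab∈T with T-nontrivial ab∈T
    ... | 1≤a , a+3≤b , _ , _ = reflects-true (isNontrivial-reflects (n ∸ 1) a b) (1≤a , a+3≤b , b≤n-1 , b+3≤a+n-1)
      where
      b≤n-1 : b ≤ n ∸ 1
      b≤n-1 = m+n≤o⇒m≤o∸n b (≤-trans (+-monoʳ-≤ b (s≤s z≤n)) (≤-trans (+-monoˡ-≤ 3 b≤r) r+3≤n))
      b+3≤a+n-1 : b + 3 ≤ a + (n ∸ 1)
      b+3≤a+n-1 = begin
        b + 3          ≤⟨ +-monoˡ-≤ 3 b≤r ⟩
        r + 3          ≤⟨ r+3≤n ⟩
        n              ≡⟨ sym 1+[n∸1]≡n ⟩
        1 + (n ∸ 1)    ≤⟨ +-monoˡ-≤ (n ∸ 1) 1≤a ⟩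
        a + (n ∸ 1)    ∎

  preimage-top : preimage r (n ∸ 1) ≡ n ∷ []
  preimage-top = trans (preimage-beyond r+1<n-1) (cong (_∷ []) 1+[n∸1]≡n)
    where
    r+1<n-1 : suc r < n ∸ 1
    r+1<n-1 = m+n≤o⇒m≤o∸n (suc (suc r)) (subst (_≤ n) (trans (+-comm r 3) (+-comm 1 (suc (suc r)))) r+3≤n)

  T-beyond : ∀ {a b} → r < a → T a b ≡ false
  T-beyond {a} {b} r<a with T a b in ab∈T
  ... | false = refl
  ... | true  = contradiction (left-end≤rIdx ab∈T) (<⇒≱ r<a)

  ear-at-rIdx? : ℕ → Bool
  ear-at-rIdx? a = (r ≡ᵇ a) ∧ (r + 3 ≡ᵇ n)

  parent-top-below : ∀ {a} → a ≤ r → parentT n T a (n ∸ 1) ≡ T a n ∧ not (ear-at-rIdx? a)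
  parent-top-below {a} a≤r =
    trans (contract-singletons {a} {n ∸ 1} (preimage-≤ a≤r) preimage-top (≤-trans a≤r (≤-trans (m≤m+n r 3) r+3≤n)))
      (trans (cong (isNontrivial (n ∸ 1) a (n ∸ 1) ∧_) (survives-away (n≢r+ 1 (s≤s (s≤s z≤n))) (n≢r+ 2 ≤-refl)))
             (∧-redundantˡ nontrivial))
    where
    n≢r+ : ∀ k → k < 3 → n ≢ r + k
    n≢r+ k k<3 = >⇒≢ (<-≤-trans (+-monoʳ-< r k<3) r+3≤n)
    nontrivial : T a n ∧ not (ear-at-rIdx? a) ≡ true → isNontrivial (n ∸ 1) a (n ∸ 1) ≡ true
    nontrivial an∈T′ with ∧-not-true an∈T′
    ... | an∈T , no-ear with T-nontrivial an∈T
    ... | 1≤a , a+3≤n , _ , n+3≤a+n =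
      reflects-true (isNontrivial-reflects (n ∸ 1) a (n ∸ 1)) (1≤a , a+3≤n-1 , ≤-refl , n-1+3≤a+n-1)
      where
      a+3≢n : a + 3 ≢ n
      a+3≢n a+3≡n = contradiction (trans (sym no-ear) ear) λ ()
        where
        r≡a : r ≡ a
        r≡a = ≤-antisym (+-cancelʳ-≤ 3 r a (subst (r + 3 ≤_) (sym a+3≡n) r+3≤n)) a≤r
        ear : ear-at-rIdx? a ≡ true
        ear rewrite ≡ᵇ-true r≡a | ≡ᵇ-true (trans (cong (_+ 3) r≡a) a+3≡n) = refl
      a+3≤n-1 : a + 3 ≤ n ∸ 1
      a+3≤n-1 = m+n≤o⇒m≤o∸n (a + 3) (subst (_≤ n) (+-comm 1 (a + 3)) (≤∧≢⇒< a+3≤n a+3≢n))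
      n-1+3≤a+n-1 : (n ∸ 1) + 3 ≤ a + (n ∸ 1)
      n-1+3≤a+n-1 = subst (_≤ a + (n ∸ 1)) (+-comm 3 (n ∸ 1))
        (+-monoˡ-≤ (n ∸ 1) (+-cancelʳ-≤ n 3 a (subst (_≤ a + n) (+-comm n 3) n+3≤a+n)))

  preimage-above : ∀ {a} → r < a → a ≤ n ∸ 2 → All (λ x → r < x × x ≤ n) (preimage r a)
  preimage-above {a} r<a a≤n-2 with m≤n⇒m<n∨m≡n r<a
  ... | inj₂ refl rewrite preimage-next r =
    (≤-refl , subst (_≤ n) (+-comm r 1) (r+k≤n 1 (s≤s z≤n))) ∷ (m<m+n r (s≤s z≤n) , r+k≤n 2 (n≤1+n 2)) ∷ []
  ... | inj₁ r+1<a rewrite preimage-beyond r+1<a =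
    (<-trans r<a (n<1+n a) , ≤-trans (s≤s a≤n-2) (≤-trans (≤-reflexive (sym (+-∸-assoc 1 2≤n))) (m∸n≤m n 1)))
    ∷ []

  parent-top-above : ∀ {a} → r < a → a ≤ n ∸ 2 → parentT n T a (n ∸ 1) ≡ false
  parent-top-above {a} r<a a≤n-2 rewrite parentT-contract n T a (n ∸ 1) | preimage-top =
    trans (cong (isNontrivial (n ∸ 1) a (n ∸ 1) ∧_) (any-none _ (All-map vanishes (preimage-above r<a a≤n-2))))
          (∧-zeroʳ _)
    where
    vanishes : ∀ {x} → r < x × x ≤ n → (survives n T r x n ∨ survives n T r n x) ∨ false ≡ false
    vanishes {x} (r<x , x≤n) rewrite T-beyond {x} {n} r<x | T-backward x≤n = refl

  ear-at-rIdx?-sound : ∀ {a} → ear-at-rIdx? a ≡ true → T a n ≡ true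
  ear-at-rIdx?-sound {a} ear with reflects-sound (≡ᵇ-reflects-≡ r a ×-reflects ≡ᵇ-reflects-≡ (r + 3) n) ear
  ... | r≡a , r+3≡n = subst₂ (λ x y → T x y ≡ true) r≡a r+3≡n (ear-at-rIdx (≤-trans (s≤s z≤n) 2≤r))

  ind-parent-top : ∀ {a} → a ≤ n ∸ 2 → ind (T a n) ≡ ind (parentT n T a (n ∸ 1)) + ind (ear-at-rIdx? a)
  ind-parent-top {a} a≤n-2 with a ≤? r
  ... | yes a≤r rewrite parent-top-below a≤r = ind-split ear-at-rIdx?-sound
  ... | no  a≰r rewrite T-beyond {a} {n} (≰⇒> a≰r) | parent-top-above (≰⇒> a≰r) a≤n-2
                      | ≡ᵇ-false {r} {a} (<⇒≢ (≰⇒> a≰r)) = refl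

  hStat-parent-below : ∀ {j} → j ≤ r → hStat T j ≡ hStat (parentT n T) j
  hStat-parent-below {j} j≤r =
    countB-cong-range 1 (j ∸ 1) (λ a 1≤a a≤j-1 → sym (parent-below (≤pred⇒< 1≤a a≤j-1) j≤r))

  hStat-parent-top : hStat T n ≡ hStat (parentT n T) (n ∸ 1) + ind (r + 3 ≡ᵇ n)
  hStat-parent-top = begin
    hStat T n
      ≡⟨ cong (countB (λ a → T a n)) (trans (cong (range 1) n-1≡1+[n-2]) (range-∷ʳ (s≤s z≤n))) ⟩
    countB (λ a → T a n) (range 1 (n ∸ 2) ∷ʳ suc (n ∸ 2))
      ≡⟨ countB-∷ʳ (λ a → T a n) (range 1 (n ∸ 2)) (suc (n ∸ 2)) ⟩
    countB (λ a → T a n) (range 1 (n ∸ 2)) + (ind (T (suc (n ∸ 2)) n) + 0)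
      ≡⟨ cong (λ x → countB (λ a → T a n) (range 1 (n ∸ 2)) + (ind x + 0)) (T-short n<n-1+3) ⟩
    countB (λ a → T a n) (range 1 (n ∸ 2)) + 0
      ≡⟨ +-identityʳ _ ⟩
    countB (λ a → T a n) (range 1 (n ∸ 2))
      ≡⟨ countB-split-range 1 (n ∸ 2) (λ a _ a≤n-2 → ind-parent-top a≤n-2) ⟩
    countB (λ a → parentT n T a (n ∸ 1)) (range 1 (n ∸ 2)) + countB ear-at-rIdx? (range 1 (n ∸ 2))
      ≡⟨ cong₂ _+_ (cong (countB (λ a → parentT n T a (n ∸ 1)) ∘ range 1) (sym (∸-+-assoc n 1 1)))
                   (countB-∧ʳ (r + 3 ≡ᵇ n) (range 1 (n ∸ 2)) (countB-≡ᵇ-range (≤-trans (s≤s z≤n) 2≤r) r≤n-2)) ⟩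
    hStat (parentT n T) (n ∸ 1) + ind (r + 3 ≡ᵇ n)
      ∎
    where
    open ≡-Reasoning
    n-1≡1+[n-2] : n ∸ 1 ≡ suc (n ∸ 2)
    n-1≡1+[n-2] = +-∸-assoc 1 2≤n
    r≤n-2 : r ≤ n ∸ 2
    r≤n-2 = m+n≤o⇒m≤o∸n r (r+k≤n 2 (n≤1+n 2))
    n<n-1+3 : n < suc (n ∸ 2) + 3
    n<n-1+3 = subst (n <_) (+-comm 3 (suc (n ∸ 2))) (s≤s (≤-trans (m≤n+m∸n n 2) (n≤1+n _)))

-- h_j = p_{n+1−j} + q_{n−j}, indexed by i = n − j to avoid truncated subtraction.
HFormula : ℕ → DiagSet → Path → Path → Set
HFormula n T P Q = ∀ i j → i + j ≡ n → 4 ≤ j → hStat T j ≡ pE P (suc i) + pE Q i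

pentagon-empty : ∀ {T} → IsTwoTri 5 T → ∀ a b → T a b ≡ false
pentagon-empty {T} tri a b with T a b in ab∈T
... | false = refl
... | true with reflects-sound (isNontrivial-reflects 5 a b) (proj₁ tri a b ab∈T)
...   | _ , a+3≤b , _ , b+3≤a+5 =
  contradiction (+-cancelˡ-≤ a 6 5 (subst (_≤ a + 5) (+-assoc a 3 3) (≤-trans (+-monoˡ-≤ 3 a+3≤b) b+3≤a+5))) 1+n≰n

hFormula-pentagon : ∀ {T} → IsTwoTri 5 T → HFormula 5 T (N ∷ E ∷ []) (N ∷ E ∷ [])
hFormula-pentagon tri i j _ _ =
  trans (countB-none (range 1 (j ∸ 1)) (λ a → pentagon-empty tri a j)) (sym (cong₂ _+_ (pE-NE (suc i)) (pE-NE i)))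
  where
  pE-NE : ∀ k → pE (N ∷ E ∷ []) k ≡ 0
  pE-NE zero          = refl
  pE-NE (suc zero)    = refl
  pE-NE (suc (suc k)) = refl

module StepCase {n T P Q} (6≤n : 6 ≤ n) (tri : IsTwoTri n T) (dPQ : IsDyckPair (n ∸ 4) P Q)
                (ih : HFormula (n ∸ 1) (parentT n T) (piP (n ∸ 4) P Q) (piQ (n ∸ 4) P Q))
                (label : labelD (n ∸ 4) P Q ≡ labelT n T) where

  open TwoTriangulation 6≤n tri

  m r s : ℕ
  m = n ∸ 4
  r = rIdx n T
  s = sIdx m P Q

  #NP : countN P ≡ m
  #NP = proj₁ (proj₁ dPQ)

  #NQ : countN Q ≡ m
  #NQ = proj₁ (proj₁ (proj₂ dPQ))

  r≤n-1 : r ≤ n ∸ 1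
  r≤n-1 = m+n≤o⇒m≤o∸n r (≤-trans (+-monoʳ-≤ r (s≤s z≤n)) rIdx+3≤n)

  r+s≡n-1 : r + s ≡ n ∸ 1
  r+s≡n-1 = trans (cong (r +_) s≡) (m+[n∸m]≡n r≤n-1)
    where
    s≡ : s ≡ n ∸ 1 ∸ r
    s≡ = begin
      s                              ≡⟨ sym (length-range 1 s) ⟩
      length (range 1 s)             ≡⟨ sym (length-reverse (range 1 s)) ⟩
      length (reverse (range 1 s))   ≡⟨ sym (length-map (λ i → pE P (suc i) + pE Q i) (reverse (range 1 s))) ⟩
      length (labelD m P Q)          ≡⟨ cong length label ⟩
      length (labelT n T)            ≡⟨ length-map (hStat T) (range (suc r) (n ∸ 1)) ⟩
      length (range (suc r) (n ∸ 1)) ≡⟨ length-range (suc r) (n ∸ 1) ⟩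
      n ∸ 1 ∸ r                      ∎
      where open ≡-Reasoning

  2≤r : 2 ≤ r
  2≤r = +-cancelʳ-≤ s 2 r (begin
    2 + s           ≤⟨ +-monoʳ-≤ 2 (sIdx≤1+m m P Q 1≤m (pE-beyond P (subst (_< suc m) (sym #NP) ≤-refl))) ⟩
    3 + m           ≡⟨ sym (+-∸-assoc 3 (≤-trans (n≤1+n 4) (≤-trans (n≤1+n 5) 6≤n))) ⟩
    n ∸ 1           ≡⟨ sym r+s≡n-1 ⟩
    r + s           ∎)
    where
    open ≤-Reasoning
    1≤m : 1 ≤ m
    1≤m = m+n≤o⇒m≤o∸n 1 (≤-trans (n≤1+n 5) 6≤n)

  open ParentTriangulation 6≤n tri 2≤r using (hStat-parent-below; hStat-parent-top)

  hStat-between : ∀ i j → i + j ≡ n → r < j → j ≤ n ∸ 1 → hStat T j ≡ pE P (suc i) + pE Q i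
  hStat-between i j i+j≡n r<j j≤n-1 =
    Equivalence.to reflect (sym label) i j (trans i+j≡n (sym (trans (+-comm (n ∸ 1) 1) 1+[n∸1]≡n))) r<j j≤n-1
    where
    reflect : labelT n T ≡ labelD m P Q ⇔
              (∀ i j → i + j ≡ n ∸ 1 + 1 → suc r ≤ j → j ≤ n ∸ 1 → hStat T j ≡ pE P (suc i) + pE Q i)
    reflect = map-range-reflect (suc r) (n ∸ 1) 1 s (s≤s r≤n-1) (trans (cong suc r+s≡n-1) (+-comm 1 (n ∸ 1)))

  hStat-below : ∀ i j → suc i + j ≡ n → 4 ≤ j → j ≤ r → hStat T j ≡ pE P (suc (suc i)) + pE Q (suc i)
  hStat-below i j 1+i+j≡n 4≤j j≤r = begin
    hStat T j                                                ≡⟨ hStat-parent-below j≤r ⟩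
    hStat (parentT n T) j                                    ≡⟨ ih i j i+j≡n-1 4≤j ⟩
    pE (piP m P Q) (suc i) + pE (piQ m P Q) i                ≡⟨ cong₂ _+_ (pE-piP-above P Q #NP (s≤s s≤i))
                                                                            (pE-piQ-above P Q #NQ s≤i) ⟩
    pE P (suc (suc i)) + pE Q (suc i)                        ∎
    where
    open ≡-Reasoning
    i+j≡n-1 : i + j ≡ n ∸ 1
    i+j≡n-1 = cong (_∸ 1) 1+i+j≡n
    s≤i : s ≤ i
    s≤i = +-cancelˡ-≤ r s i (subst₂ _≤_ (trans i+j≡n-1 (sym r+s≡n-1)) (+-comm i r) (+-monoʳ-≤ i j≤r))

  hStat-at-n : hStat T n ≡ pE P 1 + pE Q 0
  hStat-at-n = begin
    hStat T n                                                ≡⟨ hStat-parent-top ⟩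
    hStat (parentT n T) (n ∸ 1) + ind (r + 3 ≡ᵇ n)           ≡⟨ cong₂ _+_ (ih 0 (n ∸ 1) refl 4≤n-1) r+3≡n⇔s≡2 ⟩
    pE (piP m P Q) 1 + 0 + ind (s ≡ᵇ 2)                      ≡⟨ cong (_+ ind (s ≡ᵇ 2)) (+-identityʳ _) ⟩
    pE (piP m P Q) 1 + ind (s ≡ᵇ 2)                          ≡⟨ pE-piP-1 P Q dPQ 2≤m ⟩
    pE P 1                                                   ≡⟨ sym (+-identityʳ _) ⟩
    pE P 1 + 0                                               ∎
    where
    open ≡-Reasoning
    4≤n-1 : 4 ≤ n ∸ 1
    4≤n-1 = m+n≤o⇒m≤o∸n 4 (≤-trans (n≤1+n 5) 6≤n)
    2≤m : 2 ≤ m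
    2≤m = m+n≤o⇒m≤o∸n 2 6≤n
    r+3≡n⇔s≡2 : ind (r + 3 ≡ᵇ n) ≡ ind (s ≡ᵇ 2)
    r+3≡n⇔s≡2 = cong ind (≡ᵇ-≡
      (λ r+3≡n → +-cancelˡ-≡ r s 2 (trans r+s≡n-1 (trans (cong (_∸ 1) (sym r+3≡n)) (cong (_∸ 1) (+-suc r 2)))))
      (λ s≡2 → trans (+-suc r 2) (trans (cong suc (trans (cong (r +_) (sym s≡2)) r+s≡n-1)) 1+[n∸1]≡n)))

  hFormula : HFormula n T P Q
  hFormula zero    j j≡n _ = subst (λ j → hStat T j ≡ pE P 1 + pE Q 0) (sym j≡n) hStat-at-n
  hFormula (suc i) j 1+i+j≡n 4≤j with j ≤? r
  ... | yes j≤r = hStat-below i j 1+i+j≡n 4≤j j≤r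
  ... | no  j≰r = hStat-between (suc i) j 1+i+j≡n (≰⇒> j≰r) j≤n-1
    where
    j≤n-1 : j ≤ n ∸ 1
    j≤n-1 = m+n≤o⇒m≤o∸n j (≤-trans (+-monoʳ-≤ j (s≤s z≤n)) (subst (_≤ n) (+-comm (suc i) j) (≤-reflexive 1+i+j≡n)))

psiGraph⇒hFormula : ∀ {n T P Q} → PsiGraph n T P Q → HFormula n T P Q
psiGraph⇒hFormula (base T tri)                        = hFormula-pentagon tri
psiGraph⇒hFormula (step n T P Q 6≤n tri dPQ g label) = StepCase.hFormula 6≤n tri dPQ (psiGraph⇒hFormula g) label

psiGraph-size : ∀ {n T P Q} → PsiGraph n T P Q → countN P ≡ n ∸ 4
psiGraph-size (base _ _)                  = refl
psiGraph-size (step _ _ _ _ _ _ dPQ _ _) = proj₁ (proj₁ dPQ)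

map-hStat-reverse : ∀ {n T P Q} → 4 ≤ n → HFormula n T P Q →
  map (hStat T) (range 4 n) ≡ map (λ i → pE P i + pE Q (i ∸ 1)) (reverse (range 1 (n ∸ 3)))
map-hStat-reverse {n} {T} {P} {Q} 4≤n formula =
  Equivalence.from (map-range-reflect 4 n 1 (n ∸ 3) (m≤n⇒m≤1+n 4≤n) 4+[n-3]≡n+1) shifted
  where
  4+[n-3]≡n+1 : 4 + (n ∸ 3) ≡ n + 1
  4+[n-3]≡n+1 = trans (cong suc (m+[n∸m]≡n (≤-trans (n≤1+n 3) 4≤n))) (+-comm 1 n)
  shifted : ∀ i j → i + j ≡ n + 1 → 4 ≤ j → j ≤ n → hStat T j ≡ pE P i + pE Q (i ∸ 1)
  shifted zero    j j≡n+1   _   j≤n = contradiction (subst (_≤ n) j≡n+1 j≤n) (subst (_≰ n) (+-comm 1 n) 1+n≰n)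
  shifted (suc i) j 1+i+j≡n+1 4≤j _ =
    formula i j (+-cancelʳ-≡ 1 (i + j) n (trans (+-comm (i + j) 1) 1+i+j≡n+1)) 4≤j

lemma5p2 : (n : ℕ) → 5 ≤ n → (T : DiagSet) → IsTwoTri n T →
           (P Q : Path) → PsiGraph n T P Q →
           map (hStat T) (range 4 n)
             ≡ (pE Q (n ∸ 4)
                 ∷ map (λ i → pE P i + pE Q (i ∸ 1)) (reverse (range 2 (n ∸ 4))))
               ++ (pE P 1 ∷ [])
lemma5p2 n 5≤n T _ P Q g = begin
  map (hStat T) (range 4 n)                      ≡⟨ map-hStat-reverse {n} {T} {P} {Q} 4≤n (psiGraph⇒hFormula g) ⟩
  map e (reverse (range 1 (n ∸ 3)))              ≡⟨ cong (map e ∘ reverse ∘ range 1) (+-∸-assoc 1 4≤n) ⟩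
  map e (reverse (range 1 (suc (n ∸ 4))))        ≡⟨ map-reverse-range-ends e (m+n≤o⇒m≤o∸n 1 5≤n) ⟩
  (e (suc (n ∸ 4)) ∷ map e middle) ++ e 1 ∷ []   ≡⟨ cong₂ (λ x y → (x ∷ map e middle) ++ y ∷ [])
                                                          (cong (_+ pE Q (n ∸ 4)) p-last≡0) (+-identityʳ (pE P 1)) ⟩
  (pE Q (n ∸ 4) ∷ map e middle) ++ pE P 1 ∷ []   ∎
  where
  open ≡-Reasoning
  e : ℕ → ℕ
  e i = pE P i + pE Q (i ∸ 1)
  middle : List ℕ
  middle = reverse (range 2 (n ∸ 4))
  4≤n : 4 ≤ n
  4≤n = ≤-trans (n≤1+n 4) 5≤n
  p-last≡0 : pE P (suc (n ∸ 4)) ≡ 0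
  p-last≡0 = pE-beyond P (s≤s (≤-reflexive (psiGraph-size g)))
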